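{- Let $\psi:\omega\to\{0,1\}$ be any partial computable function and $\mathcal G=\mathcal N\rtimes(\mathcal H/\mathcal R)$ as in the context. Fix $r\in\mathcal G$. If $r^2\in\mathcal H/\mathcal R$, then $r\in\mathcal H/\mathcal R$ (where $\mathcal H/\mathcal R$ is identified with the subgroup $\{(\varepsilon,g):g\in\mathcal H/\mathcal R\}$ of $\mathcal G$).
   Context: Let $(p_i)_{i\in\omega}$, $(q_i)_{i\in\omega}$, $(r_i)_{i\in\omega}$ be three sequences of primes which together partition the set of odd primes. Let $\psi$ be a partial computable function with values in $\{0,1\}$; write $\psi_{\text{at } t}(i)=e$ to mean that the computation of $\psi(i)$ converges exactly at stage $t$ (and not before) with value $e$. Let $\mathcal H$ be the free abelian group, written additively, on generators $\alpha_i,\beta_i,\gamma_i$ ($i\in\omega$). Let $\mathcal R$ be the set of relations $\{\mathcal R_{i,t}:\psi(i)\text{ converges exactly at stage }t\}$, where $\mathcal R_{i,t}$ is $p_i^t\alpha_i=q_i^t\beta_i$ if $\psi_{\text{at }t}(i)=0$ and $p_i^t\alpha_i=-q_i^t\beta_i$ if $\psi_{\text{at }t}(i)=1$, and $\mathcal H/\mathcal R$ is the corresponding quotient. Let $\mathcal V_i=\mathcal R\cup\{p_i\alpha_i=0\}$, $\mathcal W_i=\mathcal R\cup\{q_i\beta_i=0\}$, $\mathcal X_i=\mathcal R\cup\{r_i\gamma_i=0\}$, $\mathcal Y_i=\mathcal R\cup\{\alpha_i=\gamma_i\}$, $\mathcal Z_i=\mathcal R\cup\{\beta_i=\gamma_i\}$,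 with corresponding quotients. Let $\mathcal N$ be the free (non-abelian) group, with identity the empty word $\varepsilon$, on the letters $u_i$ ($i\in\omega$), $v_{i,g}$ ($g\in\mathcal H/\mathcal V_i$), $w_{i,g}$ ($g\in\mathcal H/\mathcal W_i$), $x_{i,g}$ ($g\in\mathcal H/\mathcal X_i$), $y_{i,g}$ ($g\in\mathcal H/\mathcal Y_i$), $z_{i,g}$ ($g\in\mathcal H/\mathcal Z_i$), $i\in\omega$. For $g\in\mathcal H/\mathcal R$, $\varphi_g$ is the automorphism of $\mathcal N$ with $\varphi_g(u_i)=u_i$, $\varphi_g(v_{i,h})=v_{i,\bar g+h}$, and likewise for the letters $w,x,y,z$, where $\bar g$ is the image of $g$ in the relevant quotient. $\mathcal G$ is the set $\mathcal N\times(\mathcal H/\mathcal R)$ with product $(n,g)(m,h)=(n\varphi_g(m),g+h)$. -}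

module Defs where

open import Data.Nat using (ℕ; zero; suc; _^_; _<_)
open import Data.Nat.Divisibility using (_∣_)
open import Data.Nat.Primality using (Prime)
open import Data.Fin using (Fin)
open import Data.Maybe using (Maybe; just; nothing)
open import Data.List using (List; []; _∷_; _++_; map)
open import Data.Product using (Σ; _×_; _,_; ∃)
open import Data.Sum using (_⊎_)
open import Relation.Nullary using (¬_)
open import Relation.Binary.PropositionalEquality using (_≡_; _≢_)

Odd : ℕ → Set
Odd n = ¬ (2 ∣ n)

Inj : (ℕ → ℕ) → Set
Inj f = ∀ i j → f i ≡ f j → i ≡ j

record OddPrimePartition (p q r : ℕ → ℕ) : Set where
  field
    p-prime : ∀ i → Prime (p i)
    q-prime : ∀ i → Prime (q i)
    r-prime : ∀ i → Prime (r i)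
    p-odd   : ∀ i → Odd (p i)
    q-odd   : ∀ i → Odd (q i)
    r-odd   : ∀ i → Odd (r i)
    p-inj   : Inj p
    q-inj   : Inj q
    r-inj   : Inj r
    p≢q     : ∀ i j → p i ≢ q j
    p≢r     : ∀ i j → p i ≢ r j
    q≢r     : ∀ i j → q i ≢ r j
    cover   : ∀ n → Prime n → Odd n →
              (∃ λ i → p i ≡ n) ⊎ (∃ λ i → q i ≡ n) ⊎ (∃ λ i → r i ≡ n)

-- A partial function ω ⇀ {0,1} given by its stagewise computation:
-- run i s = just e  iff the computation of ψ(i) has halted with output e
-- by stage s (and then it stays halted with the same output).

record PartialFn : Set where
  field
    run  : ℕ → ℕ → Maybe (Fin 2)
    mono : ∀ i s e → run i s ≡ just e → run i (suc s) ≡ just e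

ConvAt : PartialFn → ℕ → ℕ → Fin 2 → Set
ConvAt ψ i t e = PartialFn.run ψ i t ≡ just e × (∀ s → s < t → PartialFn.run ψ i s ≡ nothing)

data Gen : Set where
  α β γ : ℕ → Gen

-- terms of the free abelian group H on the α_i, β_i, γ_i
data Term : Set where
  gen  : Gen → Term
  0#   : Term
  _⊕_  : Term → Term → Term
  ⊖_   : Term → Term

infixl 6 _⊕_
infix 8 ⊖_

_·_ : ℕ → Term → Term
zero  · x = 0#
suc n · x = x ⊕ (n · x)

infixr 7 _·_

-- a set of relations: Rl a b means "a = b" is among the imposed relations
Rels : Set₁
Rels = Term → Term → Set

-- equality in the abelian group H / Rl (congruence generated by the
-- abelian group axioms and the relations Rl)
data _⊢_≈_ (Rl : Rels) : Term → Term → Set where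
  rel      : ∀ {a b} → Rl a b → Rl ⊢ a ≈ b
  ≈refl    : ∀ {a} → Rl ⊢ a ≈ a
  ≈sym     : ∀ {a b} → Rl ⊢ a ≈ b → Rl ⊢ b ≈ a
  ≈trans   : ∀ {a b c} → Rl ⊢ a ≈ b → Rl ⊢ b ≈ c → Rl ⊢ a ≈ c
  ⊕-cong   : ∀ {a b c d} → Rl ⊢ a ≈ b → Rl ⊢ c ≈ d → Rl ⊢ (a ⊕ c) ≈ (b ⊕ d)
  ⊖-cong   : ∀ {a b} → Rl ⊢ a ≈ b → Rl ⊢ (⊖ a) ≈ (⊖ b)
  ⊕-assoc  : ∀ {a b c} → Rl ⊢ ((a ⊕ b) ⊕ c) ≈ (a ⊕ (b ⊕ c))
  ⊕-comm   : ∀ {a b} → Rl ⊢ (a ⊕ b) ≈ (b ⊕ a)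
  ⊕-idˡ    : ∀ {a} → Rl ⊢ (0# ⊕ a) ≈ a
  ⊖-invˡ   : ∀ {a} → Rl ⊢ ((⊖ a) ⊕ a) ≈ 0#

infix 4 _⊢_≈_

module Construction (p q r : ℕ → ℕ) (ψ : PartialFn) where

  data R : Rels where
    R0 : ∀ i t → ConvAt ψ i t Fin.zero →
         R ((p i ^ t) · gen (α i)) ((q i ^ t) · gen (β i))
    R1 : ∀ i t → ConvAt ψ i t (Fin.suc Fin.zero) →
         R ((p i ^ t) · gen (α i)) (⊖ ((q i ^ t) · gen (β i)))

  V W X Y Z : ℕ → Rels
  V i a b = R a b ⊎ (a ≡ p i · gen (α i) × b ≡ 0#)
  W i a b = R a b ⊎ (a ≡ q i · gen (β i) × b ≡ 0#)
  X i a b = R a b ⊎ (a ≡ r i · gen (γ i) × b ≡ 0#)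
  Y i a b = R a b ⊎ (a ≡ gen (α i) × b ≡ gen (γ i))
  Z i a b = R a b ⊎ (a ≡ gen (β i) × b ≡ gen (γ i))

  -- letters of N; v i g stands for v_{i,g} with g ∈ H/V_i given by a
  -- representative term g (likewise for w, x, y, z)
  data Letter : Set where
    u : ℕ → Letter
    v w x y z : ℕ → Term → Letter

  data _~L_ : Letter → Letter → Set where
    u~ : ∀ i → u i ~L u i
    v~ : ∀ i {g h} → V i ⊢ g ≈ h → v i g ~L v i h
    w~ : ∀ i {g h} → W i ⊢ g ≈ h → w i g ~L w i h
    x~ : ∀ i {g h} → X i ⊢ g ≈ h → x i g ~L x i h
    y~ : ∀ i {g h} → Y i ⊢ g ≈ h → y i g ~L y i h
    z~ : ∀ i {g h} → Z i ⊢ g ≈ h → z i g ~L z i h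

  data Sym : Set where
    pos neg : Letter → Sym

  -- words; the free group N is Word modulo _≈N_, identity ε = []
  Word : Set
  Word = List Sym

  ε : Word
  ε = []

  data _≈N_ : Word → Word → Set where
    ≈N-refl   : ∀ {a} → a ≈N a
    ≈N-sym    : ∀ {a b} → a ≈N b → b ≈N a
    ≈N-trans  : ∀ {a b c} → a ≈N b → b ≈N c → a ≈N c
    cancel⁺   : ∀ xs l ys → (xs ++ pos l ∷ neg l ∷ ys) ≈N (xs ++ ys)
    cancel⁻   : ∀ xs l ys → (xs ++ neg l ∷ pos l ∷ ys) ≈N (xs ++ ys)
    letter⁺   : ∀ xs {l l'} ys → l ~L l' → (xs ++ pos l ∷ ys) ≈N (xs ++ pos l' ∷ ys)
    letter⁻   : ∀ xs {l l'} ys → l ~L l' → (xs ++ neg l ∷ ys) ≈N (xs ++ neg l' ∷ ys)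

  infix 4 _≈N_ _~L_

  -- φ_g : shift of the indexing group element (g is read in each quotient)
  φL : Term → Letter → Letter
  φL g (u i)   = u i
  φL g (v i h) = v i (g ⊕ h)
  φL g (w i h) = w i (g ⊕ h)
  φL g (x i h) = x i (g ⊕ h)
  φL g (y i h) = y i (g ⊕ h)
  φL g (z i h) = z i (g ⊕ h)

  φS : Term → Sym → Sym
  φS g (pos l) = pos (φL g l)
  φS g (neg l) = neg (φL g l)

  φ : Term → Word → Word
  φ g = map (φS g)

  G : Set
  G = Word × Term

  _∙_ : G → G → G
  (n , g) ∙ (m , h) = (n ++ φ g m , g ⊕ h)

  _≈G_ : G → G → Set
  (n , g) ≈G (m , h) = (n ≈N m) × (R ⊢ g ≈ h)

  infix 4 _≈G_

  InHR : G → Set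
  InHR s = Σ Term λ g → s ≈G (ε , g)

module Submission where

-- Since s² = (n φ_g(n) , 2g), the hypothesis says n φ_g(n) = 1 in the free
-- group N, and we show n = 1.  Let m be the reduced form of n; then φ_g(m)
-- is reduced and equals m⁻¹.  Comparing m and φ_g(m) from both ends, the
-- middle of a nonempty m is either one symbol a with φ_g(a) = a⁻¹ (impossible:
-- φ_g preserves signs) or two symbols a c with φ_g(a) = c⁻¹ and φ_g(c) = a⁻¹.
-- Then φ_g(φ_g(a)) = a, i.e. 2g fixes the index of a in one of the quotients
-- H/V_i, ..., H/Z_i; these have no element of order 2, so φ_g(a) = a and
-- c = a⁻¹, contradicting reducedness.
--
-- Reduced forms need decidable equality of letters, i.e. of the quotients
-- H/V_i, ..., H/Z_i.  Both decidability and the absence of 2-torsion come from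
-- a coordinatewise description: H is the direct sum of copies of ℤ³ indexed by
-- k, and each quotient is the direct sum of the ℤ³/L_k, where L_k is spanned by
-- the relation vector (p_k^t, ∓q_k^t, 0) of R_{k,t} (present iff ψ(k) halts at
-- stage t) and by the one extra relation.  Membership in L_k is decidable since
-- p_k^t > t bounds the stages to be run, and L_k is closed under halving since
-- all the primes are odd.

open import Data.Nat as ℕ using (ℕ; zero; suc)
open import Data.Integer as ℤ using (ℤ; +_; -[1+_]; +0)
import Data.Integer.Properties as ℤP
import Data.Nat.Properties as ℕP
open import Function using (_∘_; case_of_)
open import Data.Integer.Tactic.RingSolver using (solve-∀)
open import Data.Fin using (Fin)
open import Data.Fin.Patterns using (0F; 1F; 2F)
open import Data.Product using (Σ; _×_; _,_; proj₁; proj₂)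
open import Data.Empty using (⊥; ⊥-elim)
open import Data.Sum using (_⊎_; inj₁; inj₂; [_,_])
open import Data.Maybe using (just; nothing)
open import Data.List using ([]; _∷_; _++_; foldr; length; initLast; _∷ʳ′_)
import Data.List.Properties as LP
open import Data.List.Relation.Binary.Pointwise as PW using (Pointwise; []; _∷_)
open import Data.List.Relation.Unary.Linked as Linked using (Linked; []; [-]; _∷_)
import Data.List.Relation.Unary.Linked.Properties as LinkedP
open import Data.Unit using (⊤; tt)
open import Data.Maybe.Properties using (just-injective)
open import Relation.Binary.Definitions using (tri<; tri≈; tri>)
open import Relation.Nullary using (¬_; ¬?; Dec; yes; no)
open import Relation.Nullary.Decidable as Dec using (decidable-stable)
import Data.Fin.Properties as FinP
import Data.Nat.Divisibility as ℕD
import Data.Integer.Divisibility.Signed as ℤD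
open import Data.Nat.Primality using (Prime; euclidsLemma; prime[2]; prime⇒nonTrivial)
open import Algebra.Bundles using (AbelianGroup)
open import Algebra.Structures using (IsAbelianGroup)
open import Relation.Binary.PropositionalEquality using (_≡_; _≢_; _≗_; refl; sym; trans; cong; cong₂; subst; subst₂; module ≡-Reasoning)
open import Defs

-- ℤ-multiples in H; they turn integer coordinates back into terms
infixr 7 _⊛_
_⊛_ : ℤ → Term → Term
+ n      ⊛ a = n · a
-[1+ n ] ⊛ a = ⊖ (suc n · a)

module GroupLaws (Rl : Rels) where

  isAbelianGroup : IsAbelianGroup (Rl ⊢_≈_) _⊕_ 0# ⊖_
  isAbelianGroup = record
    { isGroup = record
      { isMonoid = record
        { isSemigroup = record
          { isMagma = record
            { isEquivalence = record { refl = ≈refl ; sym = ≈sym ; trans = ≈trans }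
            ; ∙-cong = ⊕-cong }
          ; assoc = λ _ _ _ → ⊕-assoc }
        ; identity = (λ _ → ⊕-idˡ) , (λ _ → ≈trans ⊕-comm ⊕-idˡ) }
      ; inverse = (λ _ → ⊖-invˡ) , (λ _ → ≈trans ⊕-comm ⊖-invˡ)
      ; ⁻¹-cong = ⊖-cong }
    ; comm = λ _ _ → ⊕-comm }

  H/Rl : AbelianGroup _ _
  H/Rl = record { isAbelianGroup = isAbelianGroup }

  open AbelianGroup H/Rl public using (setoid; ∙-congˡ; ∙-congʳ; identityʳ; inverseʳ; commutativeSemigroup; group)
  open import Algebra.Properties.Group group public using (∙-cancelʳ; ⁻¹-involutive; ε⁻¹≈ε; x∙y⁻¹≈ε⇒x≈y; x≈y⇒x∙y⁻¹≈ε)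
  open import Algebra.Properties.AbelianGroup H/Rl public using (⁻¹-∙-comm)
  open import Algebra.Properties.CommutativeSemigroup commutativeSemigroup public using (interchange)
  open import Relation.Binary.Reasoning.Setoid setoid public

  infix 4 _≈_
  _≈_ : Term → Term → Set
  a ≈ b = Rl ⊢ a ≈ b

  ≡⇒≈ : ∀ {a b} → a ≡ b → a ≈ b
  ≡⇒≈ refl = ≈refl

  shift : ∀ a x y → (a ⊕ x) ⊕ ⊖ (a ⊕ y) ≈ x ⊕ ⊖ y
  shift a x y = begin
    (a ⊕ x) ⊕ ⊖ (a ⊕ y)   ≈⟨ ∙-congˡ (≈sym (⁻¹-∙-comm a y)) ⟩
    (a ⊕ x) ⊕ (⊖ a ⊕ ⊖ y) ≈⟨ interchange a x (⊖ a) (⊖ y) ⟩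
    (a ⊕ ⊖ a) ⊕ (x ⊕ ⊖ y) ≈⟨ ∙-congʳ (inverseʳ a) ⟩
    0# ⊕ (x ⊕ ⊖ y)        ≈⟨ ⊕-idˡ ⟩
    x ⊕ ⊖ y               ∎

  ·-congʳ : ∀ n {a b} → a ≈ b → n · a ≈ n · b
  ·-congʳ zero    e = ≈refl
  ·-congʳ (suc n) e = ⊕-cong e (·-congʳ n e)

  ·-+ : ∀ m n a → (m ℕ.+ n) · a ≈ m · a ⊕ n · a
  ·-+ zero    n a = ≈sym ⊕-idˡ
  ·-+ (suc m) n a = ≈trans (∙-congˡ (·-+ m n a)) (≈sym ⊕-assoc)

  ·-⊕ : ∀ n a b → n · (a ⊕ b) ≈ n · a ⊕ n · b
  ·-⊕ zero    a b = ≈sym ⊕-idˡ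
  ·-⊕ (suc n) a b = ≈trans (∙-congˡ (·-⊕ n a b)) (interchange a b (n · a) (n · b))

  ·-0 : ∀ n → n · 0# ≈ 0#
  ·-0 zero    = ≈refl
  ·-0 (suc n) = ≈trans ⊕-idˡ (·-0 n)


  ⊖-cancels : ∀ g h → ⊖ g ⊕ (g ⊕ h) ≈ h
  ⊖-cancels g h = ≈trans (≈sym ⊕-assoc) (≈trans (∙-congʳ ⊖-invˡ) ⊕-idˡ)

  halving : (∀ g → g ⊕ g ≈ 0# → g ≈ 0#) → ∀ {g h} → g ⊕ (g ⊕ h) ≈ h → g ⊕ h ≈ h
  halving no-2-torsion {g} {h} e = ≈trans (∙-congʳ (no-2-torsion g g+g≈0)) ⊕-idˡ
    where g+g≈0 : g ⊕ g ≈ 0#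
          g+g≈0 = ∙-cancelʳ h (g ⊕ g) 0# (≈trans ⊕-assoc (≈trans e (≈sym ⊕-idˡ)))

  ⊛-congʳ : ∀ i {a b} → a ≈ b → i ⊛ a ≈ i ⊛ b
  ⊛-congʳ (+ n)    e = ·-congʳ n e
  ⊛-congʳ -[1+ n ] e = ⊖-cong (·-congʳ (suc n) e)

  ⊛-neg : ∀ i a → (ℤ.- i) ⊛ a ≈ ⊖ (i ⊛ a)
  ⊛-neg (+ zero)  a = ≈sym ε⁻¹≈ε
  ⊛-neg (+ suc n) a = ≈refl
  ⊛-neg -[1+ n ]  a = ≈sym (⁻¹-involutive _)

  ⊛-⊖ : ∀ m n a → (m ℤ.⊖ n) ⊛ a ≈ m · a ⊕ ⊖ (n · a)
  ⊛-⊖ m       zero    a = ≈sym (≈trans (∙-congˡ ε⁻¹≈ε) (identityʳ _))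
  ⊛-⊖ zero    (suc n) a = ≈sym ⊕-idˡ
  ⊛-⊖ (suc m) (suc n) a = begin
    (suc m ℤ.⊖ suc n) ⊛ a        ≡⟨ cong (_⊛ a) (ℤP.[1+m]⊖[1+n]≡m⊖n m n) ⟩
    (m ℤ.⊖ n) ⊛ a                ≈⟨ ⊛-⊖ m n a ⟩
    m · a ⊕ ⊖ (n · a)            ≈⟨ ≈sym (shift a (m · a) (n · a)) ⟩
    suc m · a ⊕ ⊖ (suc n · a)    ∎

  ⊛-+ : ∀ i j a → (i ℤ.+ j) ⊛ a ≈ i ⊛ a ⊕ j ⊛ a
  ⊛-+ (+ m)    (+ n)    a = ·-+ m n a
  ⊛-+ (+ m)    -[1+ n ] a = ⊛-⊖ m (suc n) a
  ⊛-+ -[1+ m ] (+ n)    a = ≈trans (⊛-⊖ n (suc m) a) ⊕-comm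
  ⊛-+ -[1+ m ] -[1+ n ] a = begin
    ⊖ (suc (suc (m ℕ.+ n)) · a)      ≡⟨ cong (λ k → ⊖ (k · a)) (sym (ℕP.+-suc (suc m) n)) ⟩
    ⊖ ((suc m ℕ.+ suc n) · a)        ≈⟨ ⊖-cong (·-+ (suc m) (suc n) a) ⟩
    ⊖ (suc m · a ⊕ suc n · a)        ≈⟨ ≈sym (⁻¹-∙-comm _ _) ⟩
    ⊖ (suc m · a) ⊕ ⊖ (suc n · a)    ∎

  ⊛-*ℕ : ∀ n j a → (+ n ℤ.* j) ⊛ a ≈ n · (j ⊛ a)
  ⊛-*ℕ zero    j a = ≡⇒≈ (cong (_⊛ a) (ℤP.*-zeroˡ j))
  ⊛-*ℕ (suc n) j a = begin
    (+ suc n ℤ.* j) ⊛ a          ≡⟨ cong (_⊛ a) (unfold n j) ⟩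
    (j ℤ.+ + n ℤ.* j) ⊛ a        ≈⟨ ⊛-+ j (+ n ℤ.* j) a ⟩
    j ⊛ a ⊕ (+ n ℤ.* j) ⊛ a      ≈⟨ ∙-congˡ (⊛-*ℕ n j a) ⟩
    j ⊛ a ⊕ n · (j ⊛ a)          ∎
    where unfold : ∀ n j → + suc n ℤ.* j ≡ j ℤ.+ + n ℤ.* j
          unfold n j = trans (cong (ℤ._* j) (ℤP.pos-+ 1 n))
            (trans (ℤP.*-distribʳ-+ j (+ 1) (+ n)) (cong (ℤ._+ + n ℤ.* j) (ℤP.*-identityˡ j)))

  ⊛-* : ∀ i j a → (i ℤ.* j) ⊛ a ≈ i ⊛ (j ⊛ a)
  ⊛-* (+ n)    j a = ⊛-*ℕ n j a
  ⊛-* -[1+ n ] j a = begin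
    (-[1+ n ] ℤ.* j) ⊛ a          ≡⟨ cong (_⊛ a) (sym (ℤP.neg-distribˡ-* (+ suc n) j)) ⟩
    (ℤ.- (+ suc n ℤ.* j)) ⊛ a     ≈⟨ ⊛-neg (+ suc n ℤ.* j) a ⟩
    ⊖ ((+ suc n ℤ.* j) ⊛ a)       ≈⟨ ⊖-cong (⊛-*ℕ (suc n) j a) ⟩
    ⊖ (suc n · (j ⊛ a))           ∎

  ⊛-⊕ : ∀ i a b → i ⊛ (a ⊕ b) ≈ i ⊛ a ⊕ i ⊛ b
  ⊛-⊕ (+ n)    a b = ·-⊕ n a b
  ⊛-⊕ -[1+ n ] a b = ≈trans (⊖-cong (·-⊕ (suc n) a b)) (≈sym (⁻¹-∙-comm _ _))

  ⊛-0 : ∀ i → i ⊛ 0# ≈ 0#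
  ⊛-0 (+ n)    = ·-0 n
  ⊛-0 -[1+ n ] = ≈trans (⊖-cong (·-0 (suc n))) ε⁻¹≈ε

-- A vector is a function on the three
-- coordinates and vectors are compared pointwise (_≗_), so that an identity
-- of vectors is proved by one integer identity applied at every coordinate.
V3 : Set
V3 = Fin 3 → ℤ

vec : ℤ → ℤ → ℤ → V3
vec a b c 0F = a
vec a b c 1F = b
vec a b c 2F = c

0₃ : V3
0₃ _ = +0

infixl 6 _+₃_
infixl 7 _*₃_
_+₃_ : V3 → V3 → V3
(v +₃ w) c = v c ℤ.+ w c

_*₃_ : ℤ → V3 → V3
(i *₃ v) c = i ℤ.* v c

-₃_ : V3 → V3
(-₃ v) c = ℤ.- v c

δ : ℕ → ℕ → ℤ
δ j k with j ℕ.≟ k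
... | yes _ = + 1
... | no _  = +0

δ-same : ∀ k → δ k k ≡ + 1
δ-same k with k ℕ.≟ k
... | yes _ = refl
... | no ne = ⊥-elim (ne refl)

δ-diff : ∀ {j k} → j ≢ k → δ j k ≡ +0
δ-diff {j} {k} ne with j ℕ.≟ k
... | yes e = ⊥-elim (ne e)
... | no _  = refl

-- H is the direct sum over k of copies of ℤ³ (coordinates α_k, β_k, γ_k);
-- eval t k is the k-th component of the element represented by t.
eval : Term → ℕ → V3
eval (gen (α j)) k = vec (δ j k) +0 +0
eval (gen (β j)) k = vec +0 (δ j k) +0
eval (gen (γ j)) k = vec +0 +0 (δ j k)
eval 0#          k = 0₃
eval (a ⊕ b)     k = eval a k +₃ eval b k
eval (⊖ a)       k = -₃ eval a k

bnd : Term → ℕ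
bnd (gen (α j)) = suc j
bnd (gen (β j)) = suc j
bnd (gen (γ j)) = suc j
bnd 0#          = 0
bnd (a ⊕ b)     = bnd a ℕ.⊔ bnd b
bnd (⊖ a)       = bnd a

eval-· : ∀ n a k → eval (n · a) k ≗ (+ n) *₃ eval a k
eval-· zero    a k c = sym (ℤP.*-zeroˡ (eval a k c))
eval-· (suc n) a k c = trans (cong (λ z → eval a k c ℤ.+ z) (eval-· n a k c)) (unfold (+ n) (eval a k c))
  where unfold : ∀ m x → x ℤ.+ m ℤ.* x ≡ (+ 1 ℤ.+ m) ℤ.* x
        unfold = solve-∀

record Concentrated (t : Term) (i : ℕ) (v : V3) : Set where
  constructor concentrated-at
  field component : ∀ k → eval t k ≗ δ i k *₃ v

conc-self : ∀ {t i v} → Concentrated t i v → eval t i ≗ v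
conc-self {i = i} {v} (concentrated-at h) c = trans (h i c) (trans (cong (ℤ._* v c) (δ-same i)) (ℤP.*-identityˡ (v c)))

conc-off : ∀ {t i v} → Concentrated t i v → ∀ k → k ≢ i → eval t k ≗ 0₃
conc-off {i = i} {v} (concentrated-at h) k k≢i c = trans (h k c) (trans (cong (ℤ._* v c) (δ-diff (k≢i ∘ sym))) (ℤP.*-zeroˡ (v c)))

conc-α : ∀ i → Concentrated (gen (α i)) i (vec (+ 1) +0 +0)
conc-α i = concentrated-at λ k → λ { 0F → sym (ℤP.*-identityʳ (δ i k)) ; 1F → sym (ℤP.*-zeroʳ (δ i k)) ; 2F → sym (ℤP.*-zeroʳ (δ i k)) }

conc-β : ∀ i → Concentrated (gen (β i)) i (vec +0 (+ 1) +0)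
conc-β i = concentrated-at λ k → λ { 0F → sym (ℤP.*-zeroʳ (δ i k)) ; 1F → sym (ℤP.*-identityʳ (δ i k)) ; 2F → sym (ℤP.*-zeroʳ (δ i k)) }

conc-γ : ∀ i → Concentrated (gen (γ i)) i (vec +0 +0 (+ 1))
conc-γ i = concentrated-at λ k → λ { 0F → sym (ℤP.*-zeroʳ (δ i k)) ; 1F → sym (ℤP.*-zeroʳ (δ i k)) ; 2F → sym (ℤP.*-identityʳ (δ i k)) }

conc-0 : ∀ i → Concentrated 0# i 0₃
conc-0 i = concentrated-at λ k c → sym (ℤP.*-zeroʳ (δ i k))

conc-· : ∀ n {t i v} → Concentrated t i v → Concentrated (n · t) i (+ n *₃ v)
conc-· n {t} {i} {v} (concentrated-at h) = concentrated-at λ k c →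
  trans (eval-· n t k c) (trans (cong (+ n ℤ.*_) (h k c)) (l (+ n) (δ i k) (v c)))
  where l : ∀ n d v → n ℤ.* (d ℤ.* v) ≡ d ℤ.* (n ℤ.* v)
        l = solve-∀

conc-⊖ : ∀ {s s′ i v w} → Concentrated s i v → Concentrated s′ i w → Concentrated (s ⊕ ⊖ s′) i (v +₃ -₃ w)
conc-⊖ {i = i} {v} {w} (concentrated-at h) (concentrated-at h′) = concentrated-at λ k c →
  trans (cong₂ (λ x y → x ℤ.+ ℤ.- y) (h k c) (h′ k c)) (l (δ i k) (v c) (w c))
  where l : ∀ d v w → d ℤ.* v ℤ.+ ℤ.- (d ℤ.* w) ≡ d ℤ.* (v ℤ.+ ℤ.- w)
        l = solve-∀

block : ℕ → V3 → Term
block k v = v 0F ⊛ gen (α k) ⊕ (v 1F ⊛ gen (β k) ⊕ v 2F ⊛ gen (γ k))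

Sm : ℕ → (ℕ → Term) → Term
Sm zero    f = 0#
Sm (suc n) f = Sm n f ⊕ f n

nf : ℕ → Term → Term
nf n t = Sm n (λ k → block k (eval t k))

Line : V3 → V3 → Set
Line b v = Σ ℤ λ y → v ≗ y *₃ b

Plane : V3 → V3 → V3 → Set
Plane a b v = Σ ℤ λ x → Σ ℤ λ y → v ≗ x *₃ a +₃ y *₃ b

module NormalForm {Rl : Rels} where
  open GroupLaws Rl

  block-cong : ∀ k {v w} → v ≗ w → block k v ≈ block k w
  block-cong k e = ≡⇒≈ (cong₃ (λ a b c → a ⊛ gen (α k) ⊕ (b ⊛ gen (β k) ⊕ c ⊛ gen (γ k))) (e 0F) (e 1F) (e 2F))
    where cong₃ : ∀ {A : Set} (f : ℤ → ℤ → ℤ → A) {a a' b b' c c'} → a ≡ a' → b ≡ b' → c ≡ c' → f a b c ≡ f a' b' c'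
          cong₃ f refl refl refl = refl

  block-+ : ∀ k v w → block k (v +₃ w) ≈ block k v ⊕ block k w
  block-+ k v w = ≈trans (⊕-cong (⊛-+ (v 0F) (w 0F) _)
                    (≈trans (⊕-cong (⊛-+ (v 1F) (w 1F) _) (⊛-+ (v 2F) (w 2F) _)) (interchange _ _ _ _)))
                    (interchange _ _ _ _)

  block-* : ∀ k i v → block k (i *₃ v) ≈ i ⊛ block k v
  block-* k i v = ≈trans (⊕-cong (⊛-* i (v 0F) _)
                    (≈trans (⊕-cong (⊛-* i (v 1F) _) (⊛-* i (v 2F) _)) (≈sym (⊛-⊕ i _ _))))
                    (≈sym (⊛-⊕ i _ _))

  block-neg : ∀ k v → block k (-₃ v) ≈ ⊖ block k v
  block-neg k v = ≈trans (⊕-cong (⊛-neg (v 0F) _)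
                    (≈trans (⊕-cong (⊛-neg (v 1F) _) (⊛-neg (v 2F) _)) (⁻¹-∙-comm _ _)))
                    (⁻¹-∙-comm _ _)

  block-0 : ∀ k {v} → v ≗ 0₃ → block k v ≈ 0#
  block-0 k e = ≈trans (block-cong k e) (≈trans ⊕-idˡ ⊕-idˡ)

  Sm-cong : ∀ n {f g} → (∀ k → k ℕ.< n → f k ≈ g k) → Sm n f ≈ Sm n g
  Sm-cong zero    h = ≈refl
  Sm-cong (suc n) h = ⊕-cong (Sm-cong n (λ k lt → h k (ℕP.m<n⇒m<1+n lt))) (h n ℕP.≤-refl)

  Sm-⊕ : ∀ n f g → Sm n (λ k → f k ⊕ g k) ≈ Sm n f ⊕ Sm n g
  Sm-⊕ zero    f g = ≈sym ⊕-idˡ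
  Sm-⊕ (suc n) f g = ≈trans (∙-congʳ (Sm-⊕ n f g)) (interchange _ _ _ _)

  Sm-⊖ : ∀ n f → Sm n (λ k → ⊖ f k) ≈ ⊖ Sm n f
  Sm-⊖ zero    f = ≈sym ε⁻¹≈ε
  Sm-⊖ (suc n) f = ≈trans (∙-congʳ (Sm-⊖ n f)) (⁻¹-∙-comm _ _)

  Sm-zero : ∀ n f → (∀ k → k ℕ.< n → f k ≈ 0#) → Sm n f ≈ 0#
  Sm-zero n f h = ≈trans (Sm-cong n h) (Sm-zero′ n)
    where Sm-zero′ : ∀ n → Sm n (λ _ → 0#) ≈ 0#
          Sm-zero′ zero    = ≈refl
          Sm-zero′ (suc n) = ≈trans (identityʳ _) (Sm-zero′ n)

  Sm-single : ∀ n f j → j ℕ.< n → (∀ k → k ≢ j → f k ≈ 0#) → Sm n f ≈ f j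
  Sm-single (suc n) f j lt h with j ℕ.≟ n
  ... | yes refl = ≈trans (∙-congʳ (Sm-zero n f (λ k k<j → h k (λ { refl → ℕP.<-irrefl refl k<j })))) ⊕-idˡ
  ... | no ne    = ≈trans (⊕-cong (Sm-single n f j (ℕP.≤∧≢⇒< (ℕP.≤-pred lt) ne) h) (h n (λ e → ne (sym e))))
                          (identityʳ _)

  conc-nf : ∀ {t j v} n → Concentrated t j v → j ℕ.< n → nf n t ≈ block j (eval t j)
  conc-nf n h j<n = Sm-single n _ _ j<n (λ k k≢j → block-0 k (conc-off h k k≢j))

  nf-correct : ∀ t n → bnd t ℕ.≤ n → t ≈ nf n t
  nf-correct (gen (α j)) n le = ≈sym (begin
    nf n (gen (α j))                     ≈⟨ conc-nf n (conc-α j) le ⟩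
    block j (eval (gen (α j)) j)         ≈⟨ block-cong j (conc-self (conc-α j)) ⟩
    (gen (α j) ⊕ 0#) ⊕ (0# ⊕ 0#)         ≈⟨ ⊕-cong (identityʳ _) ⊕-idˡ ⟩
    gen (α j) ⊕ 0#                       ≈⟨ identityʳ _ ⟩
    gen (α j)                            ∎)
  nf-correct (gen (β j)) n le = ≈sym (begin
    nf n (gen (β j))                     ≈⟨ conc-nf n (conc-β j) le ⟩
    block j (eval (gen (β j)) j)         ≈⟨ block-cong j (conc-self (conc-β j)) ⟩
    0# ⊕ ((gen (β j) ⊕ 0#) ⊕ 0#)         ≈⟨ ≈trans ⊕-idˡ (identityʳ _) ⟩
    gen (β j) ⊕ 0#                       ≈⟨ identityʳ _ ⟩
    gen (β j)                            ∎)
  nf-correct (gen (γ j)) n le = ≈sym (begin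
    nf n (gen (γ j))                     ≈⟨ conc-nf n (conc-γ j) le ⟩
    block j (eval (gen (γ j)) j)         ≈⟨ block-cong j (conc-self (conc-γ j)) ⟩
    0# ⊕ (0# ⊕ (gen (γ j) ⊕ 0#))         ≈⟨ ≈trans ⊕-idˡ ⊕-idˡ ⟩
    gen (γ j) ⊕ 0#                       ≈⟨ identityʳ _ ⟩
    gen (γ j)                            ∎)
  nf-correct 0# n le = ≈sym (Sm-zero n _ (λ k _ → block-0 k {0₃} (λ _ → refl)))
  nf-correct (a ⊕ b) n le = begin
    a ⊕ b                   ≈⟨ ⊕-cong (nf-correct a n (ℕP.m⊔n≤o⇒m≤o (bnd a) (bnd b) le))
                                       (nf-correct b n (ℕP.m⊔n≤o⇒n≤o (bnd a) (bnd b) le)) ⟩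
    nf n a ⊕ nf n b         ≈⟨ ≈sym (Sm-⊕ n (λ k → block k (eval a k)) (λ k → block k (eval b k))) ⟩
    Sm n (λ k → block k (eval a k) ⊕ block k (eval b k)) ≈⟨ Sm-cong n (λ k _ → ≈sym (block-+ k (eval a k) (eval b k))) ⟩
    nf n (a ⊕ b)            ∎
  nf-correct (⊖ a) n le = begin
    ⊖ a                     ≈⟨ ⊖-cong (nf-correct a n le) ⟩
    ⊖ nf n a                ≈⟨ ≈sym (Sm-⊖ n (λ k → block k (eval a k))) ⟩
    Sm n (λ k → ⊖ block k (eval a k)) ≈⟨ Sm-cong n (λ k _ → ≈sym (block-neg k (eval a k))) ⟩
    nf n (⊖ a)              ∎

  concentrated : ∀ {t i v} → Concentrated t i v → t ≈ block i (eval t i)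
  concentrated {t} {i} h = ≈trans (nf-correct t n (ℕP.m≤n⊔m (suc i) (bnd t))) (conc-nf n h (ℕP.m≤m⊔n (suc i) (bnd t)))
    where n = suc i ℕ.⊔ bnd t

  line-vanishes : ∀ k {b v} → block k b ≈ 0# → Line b v → block k v ≈ 0#
  line-vanishes k {b} {v} b≈0 (y , h) = begin
    block k v          ≈⟨ block-cong k h ⟩
    block k (y *₃ b)   ≈⟨ block-* k y b ⟩
    y ⊛ block k b      ≈⟨ ⊛-congʳ y b≈0 ⟩
    y ⊛ 0#             ≈⟨ ⊛-0 y ⟩
    0#                 ∎

  plane-vanishes : ∀ k {a b v} → block k a ≈ 0# → block k b ≈ 0# → Plane a b v → block k v ≈ 0#
  plane-vanishes k {a} {b} {v} a≈0 b≈0 (x , y , h) = begin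
    block k v                         ≈⟨ block-cong k h ⟩
    block k (x *₃ a +₃ y *₃ b)        ≈⟨ block-+ k (x *₃ a) (y *₃ b) ⟩
    block k (x *₃ a) ⊕ block k (y *₃ b) ≈⟨ ⊕-cong (line-vanishes k {a} a≈0 (x , λ _ → refl)) (line-vanishes k {b} b≈0 (y , λ _ → refl)) ⟩
    0# ⊕ 0#                           ≈⟨ ⊕-idˡ ⟩
    0#                                ∎

record IsSubgroup (L : V3 → Set) : Set where
  field
    resp : ∀ {v w} → v ≗ w → L v → L w
    has-0 : L 0₃
    has-+ : ∀ {v w} → L v → L w → L (v +₃ w)
    has-- : ∀ {v} → L v → L (-₃ v)

-- If the relations K only relate terms whose components differ by
-- elements of subgroups L k ⊆ ℤ³, and conversely every element of L k is
-- zero in H/K, then H/K is the direct sum of the groups ℤ³/L k.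
module Coordinatewise (K : Rels) (L : ℕ → V3 → Set)
                      (subgroup : ∀ k → IsSubgroup (L k))
                      (relations-in-L : ∀ {a b} → K a b → ∀ k → L k (eval (a ⊕ ⊖ b) k))
                      (L-vanishes : ∀ k {v} → L k v → K ⊢ block k v ≈ 0#) where
  open GroupLaws K
  open NormalForm {K}

  private
    module S k = IsSubgroup (subgroup k)

    via : ∀ {k v w} → (∀ c → v c ≡ w c) → L k v → L k w
    via {k} e = S.resp k e

  complete : ∀ {a b} → a ≈ b → ∀ k → L k (eval (a ⊕ ⊖ b) k)
  complete (rel x) k = relations-in-L x k
  complete {a} ≈refl k = via (λ c → sym (ℤP.+-inverseʳ (eval a k c))) (S.has-0 k)
  complete {a} {b} (≈sym e) k =
    via (λ c → l (eval b k c) (eval a k c)) (S.has-- k (complete e k))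
    where l : ∀ a b → ℤ.- (a ℤ.+ ℤ.- b) ≡ b ℤ.+ ℤ.- a
          l = solve-∀
  complete {a} {c} (≈trans {b = b} e e′) k =
    via (λ i → l (eval a k i) (eval b k i) (eval c k i)) (S.has-+ k (complete e k) (complete e′ k))
    where l : ∀ a b c → (a ℤ.+ ℤ.- b) ℤ.+ (b ℤ.+ ℤ.- c) ≡ a ℤ.+ ℤ.- c
          l = solve-∀
  complete (⊕-cong {a} {b} {c} {d} e e′) k =
    via (λ i → l (eval a k i) (eval b k i) (eval c k i) (eval d k i)) (S.has-+ k (complete e k) (complete e′ k))
    where l : ∀ a b c d → (a ℤ.+ ℤ.- b) ℤ.+ (c ℤ.+ ℤ.- d) ≡ (a ℤ.+ c) ℤ.+ ℤ.- (b ℤ.+ d)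
          l = solve-∀
  complete (⊖-cong {a} {b} e) k =
    via (λ i → l (eval a k i) (eval b k i)) (S.has-- k (complete e k))
    where l : ∀ a b → ℤ.- (a ℤ.+ ℤ.- b) ≡ ℤ.- a ℤ.+ ℤ.- (ℤ.- b)
          l = solve-∀
  complete (⊕-assoc {a} {b} {c}) k = via (λ i → l (eval a k i) (eval b k i) (eval c k i)) (S.has-0 k)
    where l : ∀ a b c → +0 ≡ (a ℤ.+ b) ℤ.+ c ℤ.+ ℤ.- (a ℤ.+ (b ℤ.+ c))
          l = solve-∀
  complete (⊕-comm {a} {b}) k = via (λ i → l (eval a k i) (eval b k i)) (S.has-0 k)
    where l : ∀ a b → +0 ≡ (a ℤ.+ b) ℤ.+ ℤ.- (b ℤ.+ a)
          l = solve-∀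
  complete (⊕-idˡ {a}) k = via (λ i → l (eval a k i)) (S.has-0 k)
    where l : ∀ a → +0 ≡ (+0 ℤ.+ a) ℤ.+ ℤ.- a
          l = solve-∀
  complete (⊖-invˡ {a}) k = via (λ i → l (eval a k i)) (S.has-0 k)
    where l : ∀ a → +0 ≡ (ℤ.- a ℤ.+ a) ℤ.+ ℤ.- +0
          l = solve-∀

  sound-0 : ∀ t n → bnd t ℕ.≤ n → (∀ {k} → k ℕ.< n → L k (eval t k)) → t ≈ 0#
  sound-0 t n le h = ≈trans (nf-correct t n le) (Sm-zero n _ (λ k k<n → L-vanishes k (h k<n)))

  sound : ∀ a b → (∀ {k} → k ℕ.< bnd a ℕ.⊔ bnd b → L k (eval (a ⊕ ⊖ b) k)) → a ≈ b
  sound a b h = x∙y⁻¹≈ε⇒x≈y a b (sound-0 (a ⊕ ⊖ b) (bnd a ℕ.⊔ bnd b) ℕP.≤-refl h)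

  decide : (∀ k v → Dec (L k v)) → ∀ a b → Dec (a ≈ b)
  decide L? a b with ℕP.allUpTo? (λ k → L? k (eval (a ⊕ ⊖ b) k)) (bnd a ℕ.⊔ bnd b)
  ... | yes h = yes (sound a b h)
  ... | no ¬h = no (λ e → ¬h (λ {k} _ → complete e k))

  no-2-torsion : (∀ k v → L k (+ 2 *₃ v) → L k v) → ∀ g → g ⊕ g ≈ 0# → g ≈ 0#
  no-2-torsion half g e = sound-0 g (bnd g) ℕP.≤-refl
    (λ {k} _ → half k (eval g k) (via (λ c → l (eval g k c)) (complete e k)))
    where l : ∀ g → (g ℤ.+ g) ℤ.+ ℤ.- +0 ≡ + 2 ℤ.* g
          l = solve-∀

module _ {b : V3} where

  Line-subgroup : IsSubgroup (Line b)
  Line-subgroup = record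
    { resp  = λ { e (y , h) → y , λ c → trans (sym (e c)) (h c) }
    ; has-0 = +0 , λ c → sym (ℤP.*-zeroˡ (b c))
    ; has-+ = λ { (y , h) (y′ , h′) → y ℤ.+ y′ , λ c → trans (cong₂ ℤ._+_ (h c) (h′ c)) (sym (ℤP.*-distribʳ-+ (b c) y y′)) }
    ; has-- = λ { (y , h) → ℤ.- y , λ c → trans (cong ℤ.-_ (h c)) (ℤP.neg-distribˡ-* y (b c)) }
    }

module _ {a b : V3} where

  Plane-subgroup : IsSubgroup (Plane a b)
  Plane-subgroup = record
    { resp  = λ { e (x , y , h) → x , y , λ c → trans (sym (e c)) (h c) }
    ; has-0 = +0 , +0 , λ c → l0 (a c) (b c)
    ; has-+ = λ { (x , y , h) (x′ , y′ , h′) → x ℤ.+ x′ , y ℤ.+ y′ , λ c → trans (cong₂ ℤ._+_ (h c) (h′ c)) (l+ x y x′ y′ (a c) (b c)) }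
    ; has-- = λ { (x , y , h) → ℤ.- x , ℤ.- y , λ c → trans (cong ℤ.-_ (h c)) (l- x y (a c) (b c)) }
    }
    where
    l0 : ∀ a b → +0 ≡ +0 ℤ.* a ℤ.+ +0 ℤ.* b
    l0 = solve-∀
    l+ : ∀ x y x′ y′ a b → (x ℤ.* a ℤ.+ y ℤ.* b) ℤ.+ (x′ ℤ.* a ℤ.+ y′ ℤ.* b) ≡ (x ℤ.+ x′) ℤ.* a ℤ.+ (y ℤ.+ y′) ℤ.* b
    l+ = solve-∀
    l- : ∀ x y a b → ℤ.- (x ℤ.* a ℤ.+ y ℤ.* b) ≡ ℤ.- x ℤ.* a ℤ.+ ℤ.- y ℤ.* b
    l- = solve-∀

  Line⊆Plane : ∀ {v} → Line b v → Plane a b v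
  Line⊆Plane (y , h) = +0 , y , λ c → trans (h c) (l y (a c) (b c))
    where l : ∀ y a b → y ℤ.* b ≡ +0 ℤ.* a ℤ.+ y ℤ.* b
          l = solve-∀

module Halting (ψ : PartialFn) where
  open PartialFn ψ

  just≢nothing : ∀ {A : Set} {a : A} → just a ≢ nothing
  just≢nothing ()

  halted-stays : ∀ {i s s′ e} → run i s ≡ just e → s ℕ.≤ s′ → run i s′ ≡ just e
  halted-stays {s′ = zero}   h ℕ.z≤n = h
  halted-stays {s′ = suc s′} h s≤1+s′ with ℕP.m≤n⇒m<n∨m≡n s≤1+s′
  ... | inj₂ refl   = h
  ... | inj₁ s<1+s′ = mono _ s′ _ (halted-stays h (ℕP.m<1+n⇒m≤n s<1+s′))

  not-yet-halted : ∀ {i s t e} → run i s ≡ nothing → ConvAt ψ i t e → s ℕ.< t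
  not-yet-halted h (halts , _) = ℕP.≰⇒> (λ t≤s → just≢nothing (trans (sym (halted-stays halts t≤s)) h))

  conv-unique : ∀ {i t e t′ e′} → ConvAt ψ i t e → ConvAt ψ i t′ e′ → t ≡ t′ × e ≡ e′
  conv-unique {t = t} {t′ = t′} (h , before) (h′ , before′) with ℕP.<-cmp t t′
  ... | tri< t<t′ _ _ = ⊥-elim (just≢nothing (trans (sym h) (before′ t t<t′)))
  ... | tri≈ _ refl _ = refl , just-injective (trans (sym h) h′)
  ... | tri> _ _ t′<t = ⊥-elim (just≢nothing (trans (sym h′) (before t′ t′<t)))

  first-halt : ∀ i s {e} → run i s ≡ just e → Σ ℕ λ t → ConvAt ψ i t e
  first-halt i zero    h = zero , h , λ _ ()
  first-halt i (suc s) h with run i s in h′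
  ... | just e′ with first-halt i s h′
  ...   | t , conv rewrite just-injective (trans (sym (mono i s e′ h′)) h) = t , conv
  first-halt i (suc s) h | nothing = suc s , h , λ s′ s′<1+s → earlier s′ (ℕP.m<1+n⇒m≤n s′<1+s)
    where
    earlier : ∀ s′ → s′ ℕ.≤ s → run i s′ ≡ nothing
    earlier s′ s′≤s with run i s′ in h″
    ... | nothing = refl
    ... | just _  = ⊥-elim (just≢nothing (trans (sym (halted-stays h″ s′≤s)) h′))

OddZ : ℤ → Set
OddZ d = ¬ (2 ℕD.∣ ℤ.∣ d ∣)

1-odd : Odd 1
1-odd 2∣1 = case ℕD.∣1⇒≡1 2∣1 of λ ()

odd-^ : ∀ n t → Odd n → Odd (n ℕ.^ t)
odd-^ n zero    _     = 1-odd
odd-^ n (suc t) odd-n 2∣n^[1+t] with euclidsLemma n (n ℕ.^ t) prime[2] 2∣n^[1+t]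
... | inj₁ 2∣n   = odd-n 2∣n
... | inj₂ 2∣n^t = odd-^ n t odd-n 2∣n^t

even-factor : ∀ {d} → OddZ d → ∀ m y → + 2 ℤ.* m ≡ y ℤ.* d → Σ ℤ λ y′ → y ≡ y′ ℤ.* + 2
even-factor {d} odd-d m y eq with euclidsLemma ℤ.∣ y ∣ ℤ.∣ d ∣ prime[2] 2∣∣yd∣
  where
  2∣∣yd∣ : 2 ℕD.∣ ℤ.∣ y ∣ ℕ.* ℤ.∣ d ∣
  2∣∣yd∣ = ℕD.divides ℤ.∣ m ∣ (begin-≡
    ℤ.∣ y ∣ ℕ.* ℤ.∣ d ∣   ≡⟨ sym (ℤP.abs-* y d) ⟩
    ℤ.∣ y ℤ.* d ∣         ≡⟨ cong ℤ.∣_∣ (sym eq) ⟩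
    ℤ.∣ + 2 ℤ.* m ∣       ≡⟨ ℤP.abs-* (+ 2) m ⟩
    2 ℕ.* ℤ.∣ m ∣         ≡⟨ ℕP.*-comm 2 ℤ.∣ m ∣ ⟩
    ℤ.∣ m ∣ ℕ.* 2         ∎)
    where open ≡-Reasoning renaming (begin_ to begin-≡_)
... | inj₁ 2∣∣y∣ = let ℤD.divides y′ y≡y′2 = ℤD.∣ᵤ⇒∣ {+ 2} {y} 2∣∣y∣ in y′ , y≡y′2
... | inj₂ 2∣∣d∣ = ⊥-elim (odd-d 2∣∣d∣)

2*-cancel : ∀ {x z} → + 2 ℤ.* x ≡ + 2 ℤ.* z → x ≡ z
2*-cancel {x} {z} = ℤP.*-cancelˡ-≡ (+ 2) x z

OddOrZero : V3 → Set
OddOrZero b = b ≗ 0₃ ⊎ Σ (Fin 3) λ c → OddZ (b c)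

Line-half : ∀ {b v} → OddOrZero b → Line b (+ 2 *₃ v) → Line b v
Line-half {b} {v} (inj₁ b≗0) (y , h) = +0 , λ c → 2*-cancel (begin
  + 2 ℤ.* v c        ≡⟨ h c ⟩
  y ℤ.* b c          ≡⟨ cong (y ℤ.*_) (b≗0 c) ⟩
  y ℤ.* +0           ≡⟨ l y (b c) ⟩
  + 2 ℤ.* (+0 ℤ.* b c) ∎)
  where open ≡-Reasoning
        l : ∀ y b → y ℤ.* +0 ≡ + 2 ℤ.* (+0 ℤ.* b)
        l = solve-∀
Line-half {b} {v} (inj₂ (c₀ , odd)) (y , h) with even-factor odd (v c₀) y (h c₀)
... | y′ , refl = y′ , λ c → 2*-cancel (trans (h c) (l y′ (b c)))
  where l : ∀ y′ b → y′ ℤ.* + 2 ℤ.* b ≡ + 2 ℤ.* (y′ ℤ.* b)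
        l = solve-∀

_≗?_ : (v w : V3) → Dec (v ≗ w)
v ≗? w = FinP.all? (λ c → v c ℤ.≟ w c)

line? : ∀ b v → Dec (Line b v)
line? b v with FinP.any? (λ c → ¬? (b c ℤ.≟ +0))
... | yes (c , bc≢0) = line-at c bc≢0
  where
  -- using a nonzero coordinate of b to find the only candidate multiplier
  line-at : ∀ c → b c ≢ +0 → Dec (Line b v)
  line-at c bc≢0 with b c ℤD.∣? v c
  ... | no ∤ = no λ { (y , h) → ∤ (ℤD.divides y (h c)) }
  ... | yes (ℤD.divides y vc≡yb) with v ≗? (y *₃ b)
  ...   | yes h = yes (y , h)
  ...   | no ¬h = no λ { (y′ , h′) → ¬h (λ c′ → trans (h′ c′) (cong (ℤ._* b c′)
             (ℤP.*-cancelʳ-≡ y′ y (b c) {{ℤ.≢-nonZero bc≢0}} (trans (sym (h′ c)) vc≡yb)))) }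
... | no no-nonzero with v ≗? 0₃
...   | yes v≗0 = yes (+0 , λ c → trans (v≗0 c) (sym (ℤP.*-zeroˡ (b c))))
...   | no v≉0 = no λ { (y , h) → v≉0 (λ c → trans (h c) (trans (cong (y ℤ.*_) (b≗0 c)) (ℤP.*-zeroʳ y))) }
  where b≗0 : b ≗ 0₃
        b≗0 c = decidable-stable (b c ℤ.≟ +0) (λ ne → no-nonzero (c , ne))

solve-for : ∀ {v u w} → v ℤ.+ ℤ.- u ≡ w → v ≡ u ℤ.+ w
solve-for {v} {u} refl = sym (l v u)
  where l : ∀ v u → u ℤ.+ (v ℤ.+ ℤ.- u) ≡ v
        l = solve-∀

unsolve-for : ∀ {v u w} → v ≡ u ℤ.+ w → v ℤ.+ ℤ.- u ≡ w
unsolve-for {u = u} {w} refl = l u w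
  where l : ∀ u w → u ℤ.+ w ℤ.+ ℤ.- u ≡ w
        l = solve-∀

drop-zero : ∀ x y {a b} → b ≡ +0 → x ℤ.* a ℤ.+ y ℤ.* b ≡ x ℤ.* a
drop-zero x y {a} refl = trans (cong (λ z → x ℤ.* a ℤ.+ z) (ℤP.*-zeroʳ y)) (ℤP.+-identityʳ (x ℤ.* a))

-- when some coordinate c has b c = 0 and a c ≠ 0, the coefficient of a is
-- determined by that coordinate
plane? : ∀ a b v c → b c ≡ +0 → a c ≢ +0 → Dec (Plane a b v)
plane? a b v c bc≡0 ac≢0 with a c ℤD.∣? v c
... | no ∤ = no λ { (x , y , h) → ∤ (ℤD.divides x (trans (h c) (drop-zero x y bc≡0))) }
... | yes (ℤD.divides x vc≡xa) with line? b (v +₃ -₃ (x *₃ a))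
...   | yes (y , h) = yes (x , y , λ c′ → solve-for (h c′))
...   | no ¬l = no λ { (x′ , y , h) → ¬l (y , λ c′ →
          unsolve-for (trans (h c′) (cong (λ z → z ℤ.* a c′ ℤ.+ y ℤ.* b c′) (x′≡x x′ y h)))) }
  where
  x′≡x : ∀ x′ y → v ≗ x′ *₃ a +₃ y *₃ b → x′ ≡ x
  x′≡x x′ y h = ℤP.*-cancelʳ-≡ x′ x (a c) {{ℤ.≢-nonZero ac≢0}} (trans (sym (trans (h c) (drop-zero x′ y bc≡0))) vc≡xa)

n<m^n : ∀ {m} → 1 ℕ.< m → ∀ n → n ℕ.< m ℕ.^ n
n<m^n 1<m zero    = ℕP.0<1+n
n<m^n {m} 1<m (suc n) = begin-strict
  suc n                     <⟨ ℕP.+-mono-<-≤ (ℕP.≤-trans ℕP.0<1+n ih) ih ⟩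
  m ℕ.^ n ℕ.+ m ℕ.^ n       ≡⟨ cong (m ℕ.^ n ℕ.+_) (sym (ℕP.+-identityʳ (m ℕ.^ n))) ⟩
  2 ℕ.* m ℕ.^ n             ≤⟨ ℕP.*-monoˡ-≤ (m ℕ.^ n) 1<m ⟩
  m ℕ.* m ℕ.^ n             ∎
  where open ℕP.≤-Reasoning
        ih = n<m^n 1<m n

∣a∣≤∣xa∣ : ∀ x a → x ≢ +0 → ℤ.∣ a ∣ ℕ.≤ ℤ.∣ x ℤ.* a ∣
∣a∣≤∣xa∣ x a x≢0 rewrite ℤP.abs-* x a with ℤ.∣ x ∣ in ∣x∣≡
... | zero  = ⊥-elim (x≢0 (ℤP.∣i∣≡0⇒i≡0 ∣x∣≡))
... | suc m = ℕP.m≤n*m ℤ.∣ a ∣ (suc m)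

module Presentation (p q r : ℕ → ℕ) (ψ : PartialFn) where
  open Construction p q r ψ using (R; R0; R1)
  open Halting ψ

  lhs : ℕ → ℕ → Term
  lhs k t = (p k ℕ.^ t) · gen (α k)

  rhs : ℕ → ℕ → Fin 2 → Term
  rhs k t 0F = (q k ℕ.^ t) · gen (β k)
  rhs k t 1F = ⊖ ((q k ℕ.^ t) · gen (β k))

  R-at : ∀ {k t e} → ConvAt ψ k t e → R (lhs k t) (rhs k t e)
  R-at {e = 0F} c = R0 _ _ c
  R-at {e = 1F} c = R1 _ _ c

  R-inv : ∀ {a b} → R a b → Σ ℕ λ k → Σ ℕ λ t → Σ (Fin 2) λ e →
          ConvAt ψ k t e × a ≡ lhs k t × b ≡ rhs k t e
  R-inv (R0 k t c) = k , t , 0F , c , refl , refl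
  R-inv (R1 k t c) = k , t , 1F , c , refl , refl

  signed : Fin 2 → ℕ → ℤ
  signed 0F n = ℤ.- (+ n)
  signed 1F n = + n

  A : ℕ → Fin 2 → ℕ → V3
  A t e k = vec (+ (p k ℕ.^ t)) (signed e (q k ℕ.^ t)) +0

  R-components : ∀ k t e k′ → eval (lhs k t ⊕ ⊖ rhs k t e) k′ ≗ δ k k′ *₃ A t e k
  R-components k t 0F k′ c =
    trans (cong₂ (λ x y → x ℤ.+ ℤ.- y) (eval-· P (gen (α k)) k′ c) (eval-· Q (gen (β k)) k′ c)) (coord c)
    where
    P = p k ℕ.^ t
    Q = q k ℕ.^ t
    coord : ∀ c → + P ℤ.* eval (gen (α k)) k′ c ℤ.+ ℤ.- (+ Q ℤ.* eval (gen (β k)) k′ c) ≡ (δ k k′ *₃ A t 0F k) c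
    coord 0F = l (+ P) (+ Q) (δ k k′)
      where l : ∀ P Q d → P ℤ.* d ℤ.+ ℤ.- (Q ℤ.* +0) ≡ d ℤ.* P
            l = solve-∀
    coord 1F = l (+ P) (+ Q) (δ k k′)
      where l : ∀ P Q d → P ℤ.* +0 ℤ.+ ℤ.- (Q ℤ.* d) ≡ d ℤ.* ℤ.- Q
            l = solve-∀
    coord 2F = l (+ P) (+ Q) (δ k k′)
      where l : ∀ P Q d → P ℤ.* +0 ℤ.+ ℤ.- (Q ℤ.* +0) ≡ d ℤ.* +0
            l = solve-∀
  R-components k t 1F k′ c =
    trans (cong₂ (λ x y → x ℤ.+ ℤ.- ℤ.- y) (eval-· P (gen (α k)) k′ c) (eval-· Q (gen (β k)) k′ c)) (coord c)
    where
    P = p k ℕ.^ t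
    Q = q k ℕ.^ t
    coord : ∀ c → + P ℤ.* eval (gen (α k)) k′ c ℤ.+ ℤ.- ℤ.- (+ Q ℤ.* eval (gen (β k)) k′ c) ≡ (δ k k′ *₃ A t 1F k) c
    coord 0F = l (+ P) (+ Q) (δ k k′)
      where l : ∀ P Q d → P ℤ.* d ℤ.+ ℤ.- ℤ.- (Q ℤ.* +0) ≡ d ℤ.* P
            l = solve-∀
    coord 1F = l (+ P) (+ Q) (δ k k′)
      where l : ∀ P Q d → P ℤ.* +0 ℤ.+ ℤ.- ℤ.- (Q ℤ.* d) ≡ d ℤ.* Q
            l = solve-∀
    coord 2F = l (+ P) (+ Q) (δ k k′)
      where l : ∀ P Q d → P ℤ.* +0 ℤ.+ ℤ.- ℤ.- (Q ℤ.* +0) ≡ d ℤ.* +0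
            l = solve-∀

  R-vector : ∀ k t e → Concentrated (lhs k t ⊕ ⊖ rhs k t e) k (A t e k)
  R-vector k t e = concentrated-at (R-components k t e)

  Lat : (ℕ → V3) → ℕ → V3 → Set
  Lat B k v = Line (B k) v ⊎ Σ ℕ λ t → Σ (Fin 2) λ e → ConvAt ψ k t e × Plane (A t e k) (B k) v

  Lat-subgroup : ∀ B k → IsSubgroup (Lat B k)
  Lat-subgroup B k = record
    { resp  = λ { e (inj₁ l) → inj₁ (L.resp e l) ; e (inj₂ (t , e′ , c , pl)) → inj₂ (t , e′ , c , P.resp {t} {e′} e pl) }
    ; has-0 = inj₁ L.has-0
    ; has-+ = plus
    ; has-- = λ { (inj₁ l) → inj₁ (L.has-- l) ; (inj₂ (t , e , c , pl)) → inj₂ (t , e , c , P.has-- {t} {e} pl) }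
    }
    where
    module L = IsSubgroup (Line-subgroup {B k})
    module P {t e} = IsSubgroup (Plane-subgroup {A t e k} {B k})
    plus : ∀ {v w} → Lat B k v → Lat B k w → Lat B k (v +₃ w)
    plus (inj₁ l) (inj₁ l′) = inj₁ (L.has-+ l l′)
    plus (inj₁ l) (inj₂ (t , e , c , pl)) = inj₂ (t , e , c , P.has-+ {t} {e} (Line⊆Plane l) pl)
    plus (inj₂ (t , e , c , pl)) (inj₁ l) = inj₂ (t , e , c , P.has-+ {t} {e} pl (Line⊆Plane l))
    plus (inj₂ (t , e , c , pl)) (inj₂ (t′ , e′ , c′ , pl′)) with conv-unique c c′
    ... | refl , refl = inj₂ (t , e , c , P.has-+ {t} {e} pl pl′)

  ∣signed∣ : ∀ e n → ℤ.∣ signed e n ∣ ≡ n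
  ∣signed∣ 0F n = ℤP.∣-i∣≡∣i∣ (+ n)
  ∣signed∣ 1F n = refl

  Pivot : (ℕ → V3) → ℕ → Set
  Pivot B k = Σ (Fin 3) λ c → c ≢ 2F × B k c ≡ +0

  -- When all p k, q k are odd and > 1, the first two coordinates of the
  -- relation vectors are odd and exceed the stage in absolute value.  This
  -- makes the groups Lat B k decidable and closed under halving.
  module OddPowers (p>1 : ∀ k → 1 ℕ.< p k) (q>1 : ∀ k → 1 ℕ.< q k)
                   (p-odd : ∀ k → Odd (p k)) (q-odd : ∀ k → Odd (q k)) where

    A-pivot : ∀ t e k c → c ≢ 2F → t ℕ.< ℤ.∣ A t e k c ∣ × OddZ (A t e k c)
    A-pivot t e k 0F _ = n<m^n (p>1 k) t , odd-^ (p k) t (p-odd k)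
    A-pivot t e k 1F _ rewrite ∣signed∣ e (q k ℕ.^ t) = n<m^n (q>1 k) t , odd-^ (q k) t (q-odd k)
    A-pivot t e k 2F 2F≢2F = ⊥-elim (2F≢2F refl)

    A-pivot≢0 : ∀ t e k c → c ≢ 2F → A t e k c ≢ +0
    A-pivot≢0 t e k c c≢2 A≡0 = ℕP.n≮0 (subst (λ z → t ℕ.< ℤ.∣ z ∣) A≡0 (proj₁ (A-pivot t e k c c≢2)))

    not-halted⇒line : ∀ {B : ℕ → V3} {k t e v} {c : Fin 3} → c ≢ 2F → B k c ≡ +0 → PartialFn.run ψ k ℤ.∣ v c ∣ ≡ nothing →
                      ConvAt ψ k t e → Plane (A t e k) (B k) v → Line (B k) v
    not-halted⇒line {B} {k} {t} {e} {v} {c} c≢2 Bc≡0 not-halted conv (x , y , h) with x ℤ.≟ +0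
    ... | yes refl = y , λ c′ → trans (h c′) (l (A t e k c′) y (B k c′))
      where l : ∀ a y b → +0 ℤ.* a ℤ.+ y ℤ.* b ≡ y ℤ.* b
            l = solve-∀
    ... | no x≢0 = ⊥-elim (ℕP.<-irrefl refl (begin-strict
      ℤ.∣ v c ∣                 <⟨ not-yet-halted not-halted conv ⟩
      t                         <⟨ proj₁ (A-pivot t e k c c≢2) ⟩
      ℤ.∣ A t e k c ∣           ≤⟨ ∣a∣≤∣xa∣ x (A t e k c) x≢0 ⟩
      ℤ.∣ x ℤ.* A t e k c ∣     ≡⟨ cong ℤ.∣_∣ (sym (trans (h c) (drop-zero x y Bc≡0))) ⟩
      ℤ.∣ v c ∣                 ∎))
      where open ℕP.≤-Reasoning

    Lat? : ∀ B → (∀ k → Pivot B k) → ∀ k v → Dec (Lat B k v)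
    Lat? B piv k v with piv k
    ... | c , c≢2 , Bc≡0 with PartialFn.run ψ k ℤ.∣ v c ∣ in run≡
    ...   | nothing = Dec.map′ inj₁ from-Lat (line? (B k) v)
      where from-Lat : Lat B k v → Line (B k) v
            from-Lat (inj₁ l) = l
            from-Lat (inj₂ (t , e , conv , pl)) = not-halted⇒line {B} c≢2 Bc≡0 run≡ conv pl
    ...   | just e with first-halt k ℤ.∣ v c ∣ run≡
    ...     | t , conv = Dec.map′ (λ pl → inj₂ (t , e , conv , pl)) from-Lat
                           (plane? (A t e k) (B k) v c Bc≡0 (A-pivot≢0 t e k c c≢2))
      where from-Lat : Lat B k v → Plane (A t e k) (B k) v
            from-Lat (inj₁ l) = Line⊆Plane {A t e k} {B k} l
            from-Lat (inj₂ (t′ , e′ , conv′ , pl)) with conv-unique conv conv′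
            ... | refl , refl = pl

    Lat-half : ∀ B → (∀ k → Pivot B k) → (∀ k → OddOrZero (B k)) → ∀ k v → Lat B k (+ 2 *₃ v) → Lat B k v
    Lat-half B piv odd k v (inj₁ l) = inj₁ (Line-half {B k} {v} (odd k) l)
    Lat-half B piv odd k v (inj₂ (t , e , conv , x , y , h)) with piv k
    ... | c , c≢2 , Bc≡0 with even-factor (proj₂ (A-pivot t e k c c≢2)) (v c) x (trans (h c) (drop-zero x y Bc≡0))
    ...   | x′ , refl with Line-half {B k} {v +₃ -₃ (x′ *₃ A t e k)} (odd k) (y , λ c′ → halve-rest (h c′))
      where
      halve-rest : ∀ {v a yb} → + 2 ℤ.* v ≡ x′ ℤ.* + 2 ℤ.* a ℤ.+ yb → + 2 ℤ.* (v ℤ.+ ℤ.- (x′ ℤ.* a)) ≡ yb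
      halve-rest {v} {a} {yb} eq = trans (l₁ v x′ a) (unsolve-for (trans eq (cong (ℤ._+ yb) (l₂ x′ a))))
        where l₁ : ∀ v x′ a → + 2 ℤ.* (v ℤ.+ ℤ.- (x′ ℤ.* a)) ≡ + 2 ℤ.* v ℤ.+ ℤ.- (+ 2 ℤ.* (x′ ℤ.* a))
              l₁ = solve-∀
              l₂ : ∀ x′ a → x′ ℤ.* + 2 ℤ.* a ≡ + 2 ℤ.* (x′ ℤ.* a)
              l₂ = solve-∀
    ...     | y′ , h′ = inj₂ (t , e , conv , x′ , y′ , λ c′ → solve-for (h′ c′))

  module OneRelation (i : ℕ) (s s′ : Term) (B₀ : V3) (conc : Concentrated (s ⊕ ⊖ s′) i B₀) where

    K : Rels
    K a b = R a b ⊎ (a ≡ s × b ≡ s′)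

    B : ℕ → V3
    B k = eval (s ⊕ ⊖ s′) k

    off : ∀ k → k ≢ i → B k ≗ 0₃
    off = conc-off conc

    open GroupLaws K
    open NormalForm {K}

    relations-in-Lat : ∀ {a b} → K a b → ∀ k → Lat B k (eval (a ⊕ ⊖ b) k)
    relations-in-Lat (inj₂ (refl , refl)) k = inj₁ (+ 1 , λ c → sym (ℤP.*-identityˡ (B k c)))
    relations-in-Lat (inj₁ x) k′ with R-inv x
    ... | k , t , e , c , refl , refl with k′ ℕ.≟ k
    ...   | yes refl = inj₂ (t , e , c , + 1 , +0 , λ c′ → trans (conc-self (R-vector k t e) c′) (l (A t e k c′) (B k c′)))
      where l : ∀ a b → a ≡ + 1 ℤ.* a ℤ.+ +0 ℤ.* b
            l = solve-∀
    ...   | no k′≢k = IsSubgroup.resp (Lat-subgroup B k′) (λ c′ → sym (conc-off (R-vector k t e) k′ k′≢k c′))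
                        (IsSubgroup.has-0 (Lat-subgroup B k′))

    B-vanishes : ∀ k → block k (B k) ≈ 0#
    B-vanishes k with k ℕ.≟ i
    ... | yes refl = ≈trans (≈sym (concentrated conc)) (x≈y⇒x∙y⁻¹≈ε (rel (inj₂ (refl , refl))))
    ... | no k≢i   = block-0 k (off k k≢i)

    A-vanishes : ∀ {k t e} → ConvAt ψ k t e → block k (A t e k) ≈ 0#
    A-vanishes {k} {t} {e} c = begin
      block k (A t e k)                          ≈⟨ block-cong k (λ c′ → sym (conc-self (R-vector k t e) c′)) ⟩
      block k (eval (lhs k t ⊕ ⊖ rhs k t e) k)   ≈⟨ ≈sym (concentrated (R-vector k t e)) ⟩
      lhs k t ⊕ ⊖ rhs k t e                      ≈⟨ x≈y⇒x∙y⁻¹≈ε (rel (inj₁ (R-at c))) ⟩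
      0#                                         ∎

    Lat-vanishes : ∀ k {v} → Lat B k v → block k v ≈ 0#
    Lat-vanishes k (inj₁ l)                = line-vanishes k (B-vanishes k) l
    Lat-vanishes k (inj₂ (t , e , c , pl)) = plane-vanishes k {A t e k} (A-vanishes c) (B-vanishes k) pl

    open Coordinatewise K (Lat B) (Lat-subgroup B) relations-in-Lat Lat-vanishes public

    module Decidable (p>1 : ∀ k → 1 ℕ.< p k) (q>1 : ∀ k → 1 ℕ.< q k)
                     (p-odd : ∀ k → Odd (p k)) (q-odd : ∀ k → Odd (q k))
                     (pivot₀ : B₀ 0F ≡ +0 ⊎ B₀ 1F ≡ +0) (odd₀ : OddOrZero B₀) where
      open OddPowers p>1 q>1 p-odd q-odd

      pivot : ∀ k → Pivot B k
      pivot k with k ℕ.≟ i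
      ... | yes refl = [ (λ z → 0F , (λ ()) , trans (conc-self conc 0F) z)
                       , (λ z → 1F , (λ ()) , trans (conc-self conc 1F) z) ] pivot₀
      ... | no k≢i   = 0F , (λ ()) , off k k≢i 0F

      odd : ∀ k → OddOrZero (B k)
      odd k with k ℕ.≟ i
      ... | no k≢i   = inj₁ (off k k≢i)
      ... | yes refl = [ (λ B₀≗0 → inj₁ (λ c → trans (conc-self conc c) (B₀≗0 c)))
                       , (λ { (c , odd-c) → inj₂ (c , subst OddZ (sym (conc-self conc c)) odd-c) }) ] odd₀

      _≈?_ : ∀ a b → Dec (K ⊢ a ≈ b)
      _≈?_ = decide (Lat? B pivot)

      2-torsion-free : ∀ g → K ⊢ g ⊕ g ≈ 0# → K ⊢ g ≈ 0#
      2-torsion-free = no-2-torsion (Lat-half B pivot odd)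

-- The five quotients H/V_i, H/W_i, H/X_i, H/Y_i, H/Z_i have decidable
-- equality and no element of order 2: each adds to R one relation
-- concentrated at index i, with an odd coordinate and a zero among the
-- first two coordinates.
module Quotients (p q r : ℕ → ℕ) (OP : OddPrimePartition p q r) (ψ : PartialFn) where
  open OddPrimePartition OP
  open Presentation p q r ψ

  private
    prime>1 : ∀ {n} → Prime n → 1 ℕ.< n
    prime>1 {n} n-prime = ℕ.nonTrivial⇒n>1 n {{prime⇒nonTrivial n-prime}}

    p>1 : ∀ k → 1 ℕ.< p k
    p>1 k = prime>1 (p-prime k)

    q>1 : ∀ k → 1 ℕ.< q k
    q>1 k = prime>1 (q-prime k)

    n·1-0 : ∀ n → + n ℤ.* + 1 ℤ.+ ℤ.- +0 ≡ + n
    n·1-0 n = trans (ℤP.+-identityʳ _) (ℤP.*-identityʳ (+ n))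

    n·0-0 : ∀ n → + n ℤ.* +0 ℤ.+ ℤ.- +0 ≡ +0
    n·0-0 n = trans (ℤP.+-identityʳ _) (ℤP.*-zeroʳ (+ n))

  module V-quotient i = OneRelation.Decidable i (p i · gen (α i)) 0# _
    (conc-⊖ (conc-· (p i) (conc-α i)) (conc-0 i)) p>1 q>1 p-odd q-odd
    (inj₂ (n·0-0 (p i))) (inj₂ (0F , subst OddZ (sym (n·1-0 (p i))) (p-odd i)))

  module W-quotient i = OneRelation.Decidable i (q i · gen (β i)) 0# _
    (conc-⊖ (conc-· (q i) (conc-β i)) (conc-0 i)) p>1 q>1 p-odd q-odd
    (inj₁ (n·0-0 (q i))) (inj₂ (1F , subst OddZ (sym (n·1-0 (q i))) (q-odd i)))

  module X-quotient i = OneRelation.Decidable i (r i · gen (γ i)) 0# _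
    (conc-⊖ (conc-· (r i) (conc-γ i)) (conc-0 i)) p>1 q>1 p-odd q-odd
    (inj₁ (n·0-0 (r i))) (inj₂ (2F , subst OddZ (sym (n·1-0 (r i))) (r-odd i)))

  module Y-quotient i = OneRelation.Decidable i (gen (α i)) (gen (γ i)) _
    (conc-⊖ (conc-α i) (conc-γ i)) p>1 q>1 p-odd q-odd (inj₂ refl) (inj₂ (0F , 1-odd))

  module Z-quotient i = OneRelation.Decidable i (gen (β i)) (gen (γ i)) _
    (conc-⊖ (conc-β i) (conc-γ i)) p>1 q>1 p-odd q-odd (inj₁ refl) (inj₂ (1F , 1-odd))

  open Construction p q r ψ using (_~L_; u; v; w; x; y; z; u~; v~; w~; x~; y~; z~; φL; V; W; X; Y; Z)

  _≟L_ : ∀ l l′ → Dec (l ~L l′)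
  u i   ≟L u j = Dec.map′ (λ { refl → u~ i }) (λ { (u~ _) → refl }) (i ℕ.≟ j)
  v i g ≟L v j h with i ℕ.≟ j
  ... | no i≢j   = no λ { (v~ _ _) → i≢j refl }
  ... | yes refl = Dec.map′ (v~ i) (λ { (v~ _ e) → e }) (V-quotient._≈?_ i g h)
  w i g ≟L w j h with i ℕ.≟ j
  ... | no i≢j   = no λ { (w~ _ _) → i≢j refl }
  ... | yes refl = Dec.map′ (w~ i) (λ { (w~ _ e) → e }) (W-quotient._≈?_ i g h)
  x i g ≟L x j h with i ℕ.≟ j
  ... | no i≢j   = no λ { (x~ _ _) → i≢j refl }
  ... | yes refl = Dec.map′ (x~ i) (λ { (x~ _ e) → e }) (X-quotient._≈?_ i g h)
  y i g ≟L y j h with i ℕ.≟ j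
  ... | no i≢j   = no λ { (y~ _ _) → i≢j refl }
  ... | yes refl = Dec.map′ (y~ i) (λ { (y~ _ e) → e }) (Y-quotient._≈?_ i g h)
  z i g ≟L z j h with i ℕ.≟ j
  ... | no i≢j   = no λ { (z~ _ _) → i≢j refl }
  ... | yes refl = Dec.map′ (z~ i) (λ { (z~ _ e) → e }) (Z-quotient._≈?_ i g h)
  u _   ≟L v _ _ = no λ ()
  u _   ≟L w _ _ = no λ ()
  u _   ≟L x _ _ = no λ ()
  u _   ≟L y _ _ = no λ ()
  u _   ≟L z _ _ = no λ ()
  v _ _ ≟L u _   = no λ ()
  v _ _ ≟L w _ _ = no λ ()
  v _ _ ≟L x _ _ = no λ ()
  v _ _ ≟L y _ _ = no λ ()
  v _ _ ≟L z _ _ = no λ ()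
  w _ _ ≟L u _   = no λ ()
  w _ _ ≟L v _ _ = no λ ()
  w _ _ ≟L x _ _ = no λ ()
  w _ _ ≟L y _ _ = no λ ()
  w _ _ ≟L z _ _ = no λ ()
  x _ _ ≟L u _   = no λ ()
  x _ _ ≟L v _ _ = no λ ()
  x _ _ ≟L w _ _ = no λ ()
  x _ _ ≟L y _ _ = no λ ()
  x _ _ ≟L z _ _ = no λ ()
  y _ _ ≟L u _   = no λ ()
  y _ _ ≟L v _ _ = no λ ()
  y _ _ ≟L w _ _ = no λ ()
  y _ _ ≟L x _ _ = no λ ()
  y _ _ ≟L z _ _ = no λ ()
  z _ _ ≟L u _   = no λ ()
  z _ _ ≟L v _ _ = no λ ()
  z _ _ ≟L w _ _ = no λ ()
  z _ _ ≟L x _ _ = no λ ()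
  z _ _ ≟L y _ _ = no λ ()

  φL-halving : ∀ g l → φL g (φL g l) ~L l → φL g l ~L l
  φL-halving g (u i)   _        = u~ i
  φL-halving g (v i h) (v~ _ e) = v~ i (GroupLaws.halving (V i) (V-quotient.2-torsion-free i) e)
  φL-halving g (w i h) (w~ _ e) = w~ i (GroupLaws.halving (W i) (W-quotient.2-torsion-free i) e)
  φL-halving g (x i h) (x~ _ e) = x~ i (GroupLaws.halving (X i) (X-quotient.2-torsion-free i) e)
  φL-halving g (y i h) (y~ _ e) = y~ i (GroupLaws.halving (Y i) (Y-quotient.2-torsion-free i) e)
  φL-halving g (z i h) (z~ _ e) = z~ i (GroupLaws.halving (Z i) (Z-quotient.2-torsion-free i) e)


module FreeGroup (p q r : ℕ → ℕ) (ψ : PartialFn) where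
  open Construction p q r ψ
  open GroupLaws using (⊖-cancels)

  ~L-refl : ∀ {l} → l ~L l
  ~L-refl {u i}   = u~ i
  ~L-refl {v i g} = v~ i ≈refl
  ~L-refl {w i g} = w~ i ≈refl
  ~L-refl {x i g} = x~ i ≈refl
  ~L-refl {y i g} = y~ i ≈refl
  ~L-refl {z i g} = z~ i ≈refl

  ~L-sym : ∀ {l l′} → l ~L l′ → l′ ~L l
  ~L-sym (u~ i)   = u~ i
  ~L-sym (v~ i e) = v~ i (≈sym e)
  ~L-sym (w~ i e) = w~ i (≈sym e)
  ~L-sym (x~ i e) = x~ i (≈sym e)
  ~L-sym (y~ i e) = y~ i (≈sym e)
  ~L-sym (z~ i e) = z~ i (≈sym e)

  ~L-trans : ∀ {l l′ l″} → l ~L l′ → l′ ~L l″ → l ~L l″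
  ~L-trans (u~ i)   (u~ .i)    = u~ i
  ~L-trans (v~ i e) (v~ .i e′) = v~ i (≈trans e e′)
  ~L-trans (w~ i e) (w~ .i e′) = w~ i (≈trans e e′)
  ~L-trans (x~ i e) (x~ .i e′) = x~ i (≈trans e e′)
  ~L-trans (y~ i e) (y~ .i e′) = y~ i (≈trans e e′)
  ~L-trans (z~ i e) (z~ .i e′) = z~ i (≈trans e e′)

  φL-cong : ∀ g {l l′} → l ~L l′ → φL g l ~L φL g l′
  φL-cong g (u~ i)   = u~ i
  φL-cong g (v~ i e) = v~ i (⊕-cong ≈refl e)
  φL-cong g (w~ i e) = w~ i (⊕-cong ≈refl e)
  φL-cong g (x~ i e) = x~ i (⊕-cong ≈refl e)
  φL-cong g (y~ i e) = y~ i (⊕-cong ≈refl e)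
  φL-cong g (z~ i e) = z~ i (⊕-cong ≈refl e)

  φL-inverse : ∀ g l → φL (⊖ g) (φL g l) ~L l
  φL-inverse g (u i)   = u~ i
  φL-inverse g (v i h) = v~ i (⊖-cancels (V i) g h)
  φL-inverse g (w i h) = w~ i (⊖-cancels (W i) g h)
  φL-inverse g (x i h) = x~ i (⊖-cancels (X i) g h)
  φL-inverse g (y i h) = y~ i (⊖-cancels (Y i) g h)
  φL-inverse g (z i h) = z~ i (⊖-cancels (Z i) g h)

  φL-cancel : ∀ g {l l′} → φL g l ~L φL g l′ → l ~L l′
  φL-cancel g {l} {l′} e = ~L-trans (~L-sym (φL-inverse g l)) (~L-trans (φL-cong (⊖ g) e) (φL-inverse g l′))

  infix 4 _~S_
  data _~S_ : Sym → Sym → Set where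
    pos~ : ∀ {l l′} → l ~L l′ → pos l ~S pos l′
    neg~ : ∀ {l l′} → l ~L l′ → neg l ~S neg l′

  invS : Sym → Sym
  invS (pos l) = neg l
  invS (neg l) = pos l

  invS-involutive : ∀ s → invS (invS s) ≡ s
  invS-involutive (pos l) = refl
  invS-involutive (neg l) = refl

  ~S-refl : ∀ {s} → s ~S s
  ~S-refl {pos l} = pos~ ~L-refl
  ~S-refl {neg l} = neg~ ~L-refl

  ~S-sym : ∀ {s t} → s ~S t → t ~S s
  ~S-sym (pos~ e) = pos~ (~L-sym e)
  ~S-sym (neg~ e) = neg~ (~L-sym e)

  ~S-trans : ∀ {s t o} → s ~S t → t ~S o → s ~S o
  ~S-trans (pos~ e) (pos~ e′) = pos~ (~L-trans e e′)
  ~S-trans (neg~ e) (neg~ e′) = neg~ (~L-trans e e′)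

  invS-cong : ∀ {s t} → s ~S t → invS s ~S invS t
  invS-cong (pos~ e) = neg~ e
  invS-cong (neg~ e) = pos~ e

  inv-swap : ∀ {s t} → s ~S invS t → t ~S invS s
  inv-swap {s} {t} e = subst (_~S invS s) (invS-involutive t) (invS-cong (~S-sym e))

  φS-cong : ∀ g {s t} → s ~S t → φS g s ~S φS g t
  φS-cong g (pos~ e) = pos~ (φL-cong g e)
  φS-cong g (neg~ e) = neg~ (φL-cong g e)

  φS-cancel : ∀ g {s t} → φS g s ~S φS g t → s ~S t
  φS-cancel g {pos l} {pos l′} (pos~ e) = pos~ (φL-cancel g e)
  φS-cancel g {neg l} {neg l′} (neg~ e) = neg~ (φL-cancel g e)

  φS-invS : ∀ g s → φS g (invS s) ≡ invS (φS g s)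
  φS-invS g (pos l) = refl
  φS-invS g (neg l) = refl

  φS≁invS : ∀ g s → ¬ (φS g s ~S invS s)
  φS≁invS g (pos l) ()
  φS≁invS g (neg l) ()

  infix 4 _≋_
  _≋_ : Word → Word → Set
  _≋_ = Pointwise _~S_

  ≋-refl : ∀ {ws} → ws ≋ ws
  ≋-refl = PW.refl ~S-refl

  ≋-sym : ∀ {ws ws′} → ws ≋ ws′ → ws′ ≋ ws
  ≋-sym = PW.symmetric ~S-sym

  ≋-trans : ∀ {ws ws′ ws″} → ws ≋ ws′ → ws′ ≋ ws″ → ws ≋ ws″
  ≋-trans = PW.transitive ~S-trans

  ++-congˡ : ∀ xs {a b} → a ≈N b → xs ++ a ≈N xs ++ b
  ++-congˡ xs ≈N-refl            = ≈N-refl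
  ++-congˡ xs (≈N-sym e)         = ≈N-sym (++-congˡ xs e)
  ++-congˡ xs (≈N-trans e e′)    = ≈N-trans (++-congˡ xs e) (++-congˡ xs e′)
  ++-congˡ xs (cancel⁺ ys l zs)  = subst₂ _≈N_ (LP.++-assoc xs ys _) (LP.++-assoc xs ys zs) (cancel⁺ (xs ++ ys) l zs)
  ++-congˡ xs (cancel⁻ ys l zs)  = subst₂ _≈N_ (LP.++-assoc xs ys _) (LP.++-assoc xs ys zs) (cancel⁻ (xs ++ ys) l zs)
  ++-congˡ xs (letter⁺ ys zs e)  = subst₂ _≈N_ (LP.++-assoc xs ys _) (LP.++-assoc xs ys _) (letter⁺ (xs ++ ys) zs e)
  ++-congˡ xs (letter⁻ ys zs e)  = subst₂ _≈N_ (LP.++-assoc xs ys _) (LP.++-assoc xs ys _) (letter⁻ (xs ++ ys) zs e)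

  ++-congʳ : ∀ cs {a b} → a ≈N b → a ++ cs ≈N b ++ cs
  ++-congʳ cs ≈N-refl            = ≈N-refl
  ++-congʳ cs (≈N-sym e)         = ≈N-sym (++-congʳ cs e)
  ++-congʳ cs (≈N-trans e e′)    = ≈N-trans (++-congʳ cs e) (++-congʳ cs e′)
  ++-congʳ cs (cancel⁺ ys l zs)  = subst₂ _≈N_ (sym (LP.++-assoc ys _ cs)) (sym (LP.++-assoc ys zs cs)) (cancel⁺ ys l (zs ++ cs))
  ++-congʳ cs (cancel⁻ ys l zs)  = subst₂ _≈N_ (sym (LP.++-assoc ys _ cs)) (sym (LP.++-assoc ys zs cs)) (cancel⁻ ys l (zs ++ cs))
  ++-congʳ cs (letter⁺ ys zs e)  = subst₂ _≈N_ (sym (LP.++-assoc ys _ cs)) (sym (LP.++-assoc ys _ cs)) (letter⁺ ys (zs ++ cs) e)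
  ++-congʳ cs (letter⁻ ys zs e)  = subst₂ _≈N_ (sym (LP.++-assoc ys _ cs)) (sym (LP.++-assoc ys _ cs)) (letter⁻ ys (zs ++ cs) e)

  ++-cong : ∀ {a a′ b b′} → a ≈N a′ → b ≈N b′ → a ++ b ≈N a′ ++ b′
  ++-cong {a′ = a′} {b} e e′ = ≈N-trans (++-congʳ b e) (++-congˡ a′ e′)

  φ-cong : ∀ g {a b} → a ≈N b → φ g a ≈N φ g b
  φ-cong g ≈N-refl           = ≈N-refl
  φ-cong g (≈N-sym e)        = ≈N-sym (φ-cong g e)
  φ-cong g (≈N-trans e e′)   = ≈N-trans (φ-cong g e) (φ-cong g e′)
  φ-cong g (cancel⁺ ys l zs) = subst₂ _≈N_ (sym (LP.map-++ (φS g) ys _)) (sym (LP.map-++ (φS g) ys zs)) (cancel⁺ (φ g ys) (φL g l) (φ g zs))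
  φ-cong g (cancel⁻ ys l zs) = subst₂ _≈N_ (sym (LP.map-++ (φS g) ys _)) (sym (LP.map-++ (φS g) ys zs)) (cancel⁻ (φ g ys) (φL g l) (φ g zs))
  φ-cong g (letter⁺ ys zs e) = subst₂ _≈N_ (sym (LP.map-++ (φS g) ys _)) (sym (LP.map-++ (φS g) ys _)) (letter⁺ (φ g ys) (φ g zs) (φL-cong g e))
  φ-cong g (letter⁻ ys zs e) = subst₂ _≈N_ (sym (LP.map-++ (φS g) ys _)) (sym (LP.map-++ (φS g) ys _)) (letter⁻ (φ g ys) (φ g zs) (φL-cong g e))

  ≋⇒≈N : ∀ {a b} → a ≋ b → a ≈N b
  ≋⇒≈N []                           = ≈N-refl
  ≋⇒≈N (_∷_ {y = t} (pos~ e) es) = ≈N-trans (letter⁺ [] _ e) (++-congˡ (t ∷ []) (≋⇒≈N es))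
  ≋⇒≈N (_∷_ {y = t} (neg~ e) es) = ≈N-trans (letter⁻ [] _ e) (++-congˡ (t ∷ []) (≋⇒≈N es))

  cancel-inv : ∀ s zs → (s ∷ invS s ∷ zs) ≈N zs
  cancel-inv (pos l) zs = cancel⁺ [] l zs
  cancel-inv (neg l) zs = cancel⁻ [] l zs

  module Reduction (_≟L_ : ∀ l l′ → Dec (l ~L l′)) where

    _≟S_ : ∀ s t → Dec (s ~S t)
    pos l ≟S pos l′ = Dec.map′ pos~ (λ { (pos~ e) → e }) (l ≟L l′)
    neg l ≟S neg l′ = Dec.map′ neg~ (λ { (neg~ e) → e }) (l ≟L l′)
    pos l ≟S neg l′ = no λ ()
    neg l ≟S pos l′ = no λ ()

    NoCancel : Sym → Sym → Set
    NoCancel s t = ¬ (t ~S invS s)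

    Reduced : Word → Set
    Reduced = Linked NoCancel

    push : Sym → Word → Word
    push s []       = s ∷ []
    push s (t ∷ ws) with t ≟S invS s
    ... | yes _ = ws
    ... | no _  = s ∷ t ∷ ws

    push* : Word → Word → Word
    push* xs zs = foldr push zs xs

    ⟦_⟧ : Word → Word
    ⟦ ws ⟧ = push* ws []

    push*-++ : ∀ xs ys zs → push* (xs ++ ys) zs ≡ push* xs (push* ys zs)
    push*-++ []       ys zs = refl
    push*-++ (s ∷ xs) ys zs = cong (push s) (push*-++ xs ys zs)

    push-reduced : ∀ s ws → Reduced ws → Reduced (push s ws)
    push-reduced s []       _  = [-]
    push-reduced s (t ∷ ws) rd with t ≟S invS s
    ... | yes _ = Linked.tail rd
    ... | no nc = nc ∷ rd

    push*-reduced : ∀ xs zs → Reduced zs → Reduced (push* xs zs)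
    push*-reduced []       zs rd = rd
    push*-reduced (s ∷ xs) zs rd = push-reduced s _ (push*-reduced xs zs rd)

    ⟦⟧-reduced : ∀ ws → Reduced ⟦ ws ⟧
    ⟦⟧-reduced ws = push*-reduced ws [] []

    push-cong : ∀ {s s′ a b} → s ~S s′ → a ≋ b → push s a ≋ push s′ b
    push-cong e [] = e ∷ []
    push-cong {s} {s′} e (_∷_ {x = t} {y = t′} et es) with t ≟S invS s | t′ ≟S invS s′
    ... | yes _  | yes _  = es
    ... | yes c  | no ¬c′ = ⊥-elim (¬c′ (~S-trans (~S-sym et) (~S-trans c (invS-cong e))))
    ... | no ¬c  | yes c′ = ⊥-elim (¬c (~S-trans et (~S-trans c′ (invS-cong (~S-sym e)))))
    ... | no _   | no _   = e ∷ et ∷ es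

    push*-cong : ∀ xs {a b} → a ≋ b → push* xs a ≋ push* xs b
    push*-cong []       e = e
    push*-cong (s ∷ xs) e = push-cong ~S-refl (push*-cong xs e)

    push-inverse : ∀ s s′ ws → s′ ~S invS s → Reduced ws → push s′ (push s ws) ≋ ws
    push-inverse s s′ [] e _ with s ≟S invS s′
    ... | yes _ = []
    ... | no ¬c = ⊥-elim (¬c (inv-swap e))
    push-inverse s s′ (t ∷ ws) e rd with t ≟S invS s
    push-inverse s s′ (t ∷ []) e rd | yes c = ~S-trans e (~S-sym c) ∷ []
    push-inverse s s′ (t ∷ t′ ∷ ws) e (nc ∷ rd) | yes c with t′ ≟S invS s′
    ... | yes c′ = ⊥-elim (nc (~S-trans c′ (~S-trans (subst (invS s′ ~S_) (invS-involutive s) (invS-cong e)) (inv-swap c))))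
    ... | no _   = ~S-trans e (~S-sym c) ∷ ≋-refl
    push-inverse s s′ (t ∷ ws) e rd | no _ with s ≟S invS s′
    ... | yes _ = ≋-refl
    ... | no ¬c = ⊥-elim (¬c (inv-swap e))

    ⟦⟧-resp : ∀ {a b} → a ≈N b → ⟦ a ⟧ ≋ ⟦ b ⟧
    ⟦⟧-resp ≈N-refl         = ≋-refl
    ⟦⟧-resp (≈N-sym e)      = ≋-sym (⟦⟧-resp e)
    ⟦⟧-resp (≈N-trans e e′) = ≋-trans (⟦⟧-resp e) (⟦⟧-resp e′)
    ⟦⟧-resp (cancel⁺ xs l ys) rewrite push*-++ xs (pos l ∷ neg l ∷ ys) [] | push*-++ xs ys [] =
      push*-cong xs (push-inverse (neg l) (pos l) ⟦ ys ⟧ ~S-refl (⟦⟧-reduced ys))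
    ⟦⟧-resp (cancel⁻ xs l ys) rewrite push*-++ xs (neg l ∷ pos l ∷ ys) [] | push*-++ xs ys [] =
      push*-cong xs (push-inverse (pos l) (neg l) ⟦ ys ⟧ ~S-refl (⟦⟧-reduced ys))
    ⟦⟧-resp (letter⁺ xs {l} {l′} ys e) rewrite push*-++ xs (pos l ∷ ys) [] | push*-++ xs (pos l′ ∷ ys) [] =
      push*-cong xs (push-cong {a = ⟦ ys ⟧} (pos~ e) ≋-refl)
    ⟦⟧-resp (letter⁻ xs {l} {l′} ys e) rewrite push*-++ xs (neg l ∷ ys) [] | push*-++ xs (neg l′ ∷ ys) [] =
      push*-cong xs (push-cong {a = ⟦ ys ⟧} (neg~ e) ≋-refl)

    push-≈N : ∀ s zs → push s zs ≈N (s ∷ zs)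
    push-≈N s []       = ≈N-refl
    push-≈N s (t ∷ zs) with t ≟S invS s
    ... | yes c = ≈N-sym (≈N-trans (≋⇒≈N (~S-refl ∷ c ∷ ≋-refl)) (cancel-inv s zs))
    ... | no _  = ≈N-refl

    ≈N-⟦⟧ : ∀ ws → ws ≈N ⟦ ws ⟧
    ≈N-⟦⟧ []       = ≈N-refl
    ≈N-⟦⟧ (s ∷ ws) = ≈N-trans (++-congˡ (s ∷ []) (≈N-⟦⟧ ws)) (≈N-sym (push-≈N s ⟦ ws ⟧))

    reduced-fixed : ∀ ws → Reduced ws → ⟦ ws ⟧ ≋ ws
    reduced-fixed []           _         = []
    reduced-fixed (s ∷ [])     _         = ≋-refl
    reduced-fixed (s ∷ t ∷ ws) (nc ∷ rd) = ≋-trans (push-cong ~S-refl (reduced-fixed (t ∷ ws) rd)) push-no-cancel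
      where
      push-no-cancel : push s (t ∷ ws) ≋ (s ∷ t ∷ ws)
      push-no-cancel with t ≟S invS s
      ... | yes c = ⊥-elim (nc c)
      ... | no _  = ≋-refl

    inverse-onto : Word → Word → Word
    inverse-onto []      acc = acc
    inverse-onto (s ∷ m) acc = inverse-onto m (invS s ∷ acc)

    _⁻¹ʷ : Word → Word
    m ⁻¹ʷ = inverse-onto m []

    inverse-onto-++ : ∀ m acc → inverse-onto m acc ≡ m ⁻¹ʷ ++ acc
    inverse-onto-++ []      acc = refl
    inverse-onto-++ (s ∷ m) acc = begin
      inverse-onto m (invS s ∷ acc)               ≡⟨ inverse-onto-++ m (invS s ∷ acc) ⟩
      m ⁻¹ʷ ++ invS s ∷ acc                       ≡⟨ sym (LP.++-assoc (m ⁻¹ʷ) (invS s ∷ []) acc) ⟩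
      (m ⁻¹ʷ ++ invS s ∷ []) ++ acc               ≡⟨ cong (_++ acc) (sym (inverse-onto-++ m (invS s ∷ []))) ⟩
      inverse-onto m (invS s ∷ []) ++ acc         ∎
      where open ≡-Reasoning

    inverse-onto-concat : ∀ xs ys acc → inverse-onto (xs ++ ys) acc ≡ inverse-onto ys (inverse-onto xs acc)
    inverse-onto-concat []       ys acc = refl
    inverse-onto-concat (s ∷ xs) ys acc = inverse-onto-concat xs ys (invS s ∷ acc)

    push*-inverse : ∀ m zs → Reduced zs → push* (m ⁻¹ʷ) (push* m zs) ≋ zs
    push*-inverse []      zs rd = ≋-refl
    push*-inverse (s ∷ m) zs rd rewrite inverse-onto-++ m (invS s ∷ []) | push*-++ (m ⁻¹ʷ) (invS s ∷ []) (push s (push* m zs)) =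
      ≋-trans (push*-cong (m ⁻¹ʷ) (push-inverse s (invS s) (push* m zs) ~S-refl (push*-reduced m zs rd)))
              (push*-inverse m zs rd)

    Junction : Word → Word → Set
    Junction _       []      = ⊤
    Junction []      (_ ∷ _) = ⊤
    Junction (s ∷ _) (a ∷ _) = ¬ (a ~S s)

    inverse-onto-reduced : ∀ m acc → Reduced m → Reduced acc → Junction m acc → Reduced (inverse-onto m acc)
    inverse-onto-reduced []      acc _    racc _ = racc
    inverse-onto-reduced (s ∷ m) acc rsm  racc j =
      inverse-onto-reduced m (invS s ∷ acc) (Linked.tail rsm) (extend acc racc j) (junction m rsm)
      where
      extend : ∀ acc → Reduced acc → Junction (s ∷ m) acc → Reduced (invS s ∷ acc)
      extend []        _    _ = [-]
      extend (a ∷ acc) racc j = (λ e → j (subst (a ~S_) (invS-involutive s) e)) ∷ racc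
      junction : ∀ m → Reduced (s ∷ m) → Junction m (invS s ∷ acc)
      junction []       _        = tt
      junction (s′ ∷ m) (nc ∷ _) = λ e → nc (~S-sym e)

    ⁻¹ʷ-reduced : ∀ m → Reduced m → Reduced (m ⁻¹ʷ)
    ⁻¹ʷ-reduced m rm = inverse-onto-reduced m [] rm [] tt

    φ-reduced : ∀ g m → Reduced m → Reduced (φ g m)
    φ-reduced g m rm = LinkedP.map⁺ (Linked.map (λ nc e → nc (φS-cancel g (subst (φS g _ ~S_) (sym (φS-invS g _)) e))) rm)

    ∷ʳ-split : ∀ {xs ys a b} → (xs ++ a ∷ []) ≋ (ys ++ b ∷ []) → xs ≋ ys × a ~S b
    ∷ʳ-split {[]}         {[]}         (e ∷ [])  = [] , e
    ∷ʳ-split {[]}         {_ ∷ _ ∷ _} (_ ∷ ())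
    ∷ʳ-split {[]}         {_ ∷ []}     (_ ∷ ())
    ∷ʳ-split {_ ∷ []}     {[]}         (_ ∷ ())
    ∷ʳ-split {_ ∷ _ ∷ _} {[]}         (_ ∷ ())
    ∷ʳ-split {_ ∷ xs}     {_ ∷ ys}     (e ∷ es) with ∷ʳ-split {xs} {ys} es
    ... | es′ , e′ = e ∷ es′ , e′

    reduced-init : ∀ k c → Reduced (k ++ c ∷ []) → Reduced k
    reduced-init []           c _         = []
    reduced-init (s ∷ [])     c _         = [-]
    reduced-init (s ∷ t ∷ k)  c (nc ∷ rd) = nc ∷ reduced-init (t ∷ k) c rd

    -- If φ_g fixes every letter whose image under
    -- φ_g ∘ φ_g it fixes, then a reduced word m with φ_g(m) = m⁻¹ is empty:
    -- comparing first and last symbols, m = a k c with φ(a) = c⁻¹, φ(c) = a⁻¹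
    -- and φ(k) = k⁻¹; inductively k is empty, and then φ(φ(a)) = a forces
    -- φ(a) = a, so c = a⁻¹, contradicting reducedness.  (A single symbol a
    -- cannot satisfy φ(a) = a⁻¹ since φ preserves signs.)
    module _ (φL-halving : ∀ g l → φL g (φL g l) ~L l → φL g l ~L l) where

      φS-halve : ∀ g s → φS g (φS g s) ~S s → φS g s ~S s
      φS-halve g (pos l) (pos~ e) = pos~ (φL-halving g l e)
      φS-halve g (neg l) (neg~ e) = neg~ (φL-halving g l e)

      palindrome : ∀ g n m → length m ℕ.≤ n → Reduced m → φ g m ≋ m ⁻¹ʷ → m ≡ []
      palindrome g n       []       _  _  _  = refl
      palindrome g zero    (a ∷ _)  () _  _
      palindrome g (suc n) (a ∷ m′) le rm eq with initLast m′
      palindrome g (suc n) (a ∷ _)  le rm (e ∷ []) | [] = ⊥-elim (φS≁invS g a e)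
      ... | k ∷ʳ′ c = ⊥-elim (ends-cancel k≡[])
        where
        split : φ g (a ∷ k ++ c ∷ []) ≡ φS g a ∷ (φ g k ++ φS g c ∷ [])
        split = cong (φS g a ∷_) (LP.map-++ (φS g) k (c ∷ []))
        split⁻¹ : (a ∷ k ++ c ∷ []) ⁻¹ʷ ≡ invS c ∷ (k ⁻¹ʷ ++ invS a ∷ [])
        split⁻¹ = trans (inverse-onto-concat k (c ∷ []) (invS a ∷ [])) (cong (invS c ∷_) (inverse-onto-++ k (invS a ∷ [])))
        outer : φS g a ~S invS c × (φ g k ++ φS g c ∷ []) ≋ (k ⁻¹ʷ ++ invS a ∷ [])
        outer with subst₂ _≋_ split split⁻¹ eq
        ... | e ∷ es = e , es
        k-bound : length k ℕ.≤ n
        k-bound = ℕP.≤-trans (ℕP.≤-trans (ℕP.m≤m+n (length k) 1) (ℕP.≤-reflexive (sym (LP.length-++ k))))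
                             (ℕP.≤-pred le)
        inner : φ g k ≋ k ⁻¹ʷ × φS g c ~S invS a
        inner = ∷ʳ-split {φ g k} {k ⁻¹ʷ} (proj₂ outer)
        k≡[] : k ≡ []
        k≡[] = palindrome g n k k-bound (reduced-init k c (Linked.tail rm)) (proj₁ inner)
        ends-cancel : k ≡ [] → ⊥
        ends-cancel refl = Linked.head rm (inv-swap (~S-trans (~S-sym φa~a) (proj₁ outer)))
          where
          φφa~a : φS g (φS g a) ~S a
          φφa~a = ~S-trans (φS-cong g (proj₁ outer))
                    (subst₂ _~S_ (sym (φS-invS g c)) (invS-involutive a) (invS-cong (proj₂ inner)))
          φa~a : φS g a ~S a
          φa~a = φS-halve g a φφa~a

      fixed-inverse-trivial : ∀ n g → (n ++ φ g n) ≈N ε → n ≈N ε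
      fixed-inverse-trivial n g hyp = ≈N-trans (≈N-⟦⟧ n) (subst (_≈N ε) (sym m≡[]) ≈N-refl)
        where
        m = ⟦ n ⟧
        m-reduced : Reduced m
        m-reduced = ⟦⟧-reduced n
        mφm≈ε : (m ++ φ g m) ≈N ε
        mφm≈ε = ≈N-trans (++-cong (≈N-sym (≈N-⟦⟧ n)) (φ-cong g (≈N-sym (≈N-⟦⟧ n)))) hyp
        m-annihilates : push* m ⟦ φ g m ⟧ ≋ []
        m-annihilates = subst (_≋ []) (push*-++ m (φ g m) []) (⟦⟧-resp mφm≈ε)
        φm≋m⁻¹ : φ g m ≋ m ⁻¹ʷ
        φm≋m⁻¹ = ≋-trans (≋-sym (reduced-fixed (φ g m) (φ-reduced g m m-reduced)))
                 (≋-trans (≋-sym (push*-inverse m ⟦ φ g m ⟧ (⟦⟧-reduced (φ g m))))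
                 (≋-trans (push*-cong (m ⁻¹ʷ) m-annihilates)
                          (reduced-fixed (m ⁻¹ʷ) (⁻¹ʷ-reduced m m-reduced))))
        m≡[] : m ≡ []
        m≡[] = palindrome g (length m) m ℕP.≤-refl m-reduced φm≋m⁻¹

lemma5p3 : (p q r : ℕ → ℕ) → OddPrimePartition p q r → (ψ : PartialFn) →
           let open Construction p q r ψ in
           (s : G) → InHR (s ∙ s) → InHR s
lemma5p3 p q r OP ψ (n , g) (_ , n·φn≈ε , _) = g , fixed-inverse-trivial φL-halving n g n·φn≈ε , ≈refl
  where
  open Quotients p q r OP ψ using (_≟L_; φL-halving)
  open FreeGroup.Reduction p q r ψ _≟L_ using (fixed-inverse-trivial)
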